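{- For a polygonal 2-tree $G$, the set of induced cycles of $G$ is the unique minimum cycle basis of $G$.
   Context: All graphs are finite, simple, undirected and unweighted. A polygonal 2-tree is defined recursively: every cycle is a polygonal 2-tree; if $G$ is a polygonal 2-tree and $(u,v) \in E(G)$, then adding a new path $P$ between $u$ and $v$ with $E(G) \cap E(P) = \emptyset$, $V(G) \cap V(P) = \{u,v\}$ and $|E(P)| \geq 2$ yields a polygonal 2-tree. An induced cycle is a chordless cycle. A graph is Eulerian if every vertex has even degree. For subgraphs $H_1,\ldots,H_k$, $H_1 \oplus \cdots \oplus H_k$ is the graph consisting of the edges appearing in an odd number of the $H_i$. A cycle basis of $G$ is a minimal set $\mathcal{B}$ of Eulerian subgraphs of $G$ such that every cycle of $G$ is the $\oplus$-sum of a subset of $\mathcal{B}$. A minimum cycle basis is a cycle basis minimizing the total number of edges of its members. -}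

module Defs where

open import Data.Nat using (ℕ; zero; suc; _≤_; _<_; _∸_)
open import Data.Nat.Divisibility using (_∣_)
open import Data.Fin using (Fin; toℕ; _≟_)
open import Data.Product using (Σ; ∃; ∃-syntax; _×_; _,_; proj₁; proj₂)
open import Data.Sum using (_⊎_)
open import Data.Bool using (Bool; _xor_; _∨_)
open import Data.Vec using (zipWith; tabulate)
open import Data.List using (List; foldr; map; length)
open import Data.Nat.ListAction using (sum)
open import Data.Fin.Subset as FS using (Subset; ∣_∣; _∩_)
open import Data.List.Membership.Propositional as LM using ()
open import Data.List.Relation.Binary.Sublist.Propositional as SL using ()
open import Data.List.Relation.Unary.Unique.Propositional using (Unique)
open import Data.List.Relation.Unary.All using (All)
open import Function.Bundles using (_⇔_)
open import Function.Definitions using (Injective; Surjective)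
open import Relation.Binary.PropositionalEquality using (_≡_; _≢_)
open import Relation.Nullary using (¬_)
open import Relation.Nullary.Decidable using (⌊_⌋)

Joins : ∀ {n} → Fin n × Fin n → Fin n → Fin n → Set
Joins p u v = p ≡ (u , v) ⊎ p ≡ (v , u)

record Graph : Set where
  field
    n     : ℕ
    m     : ℕ
    ends  : Fin m → Fin n × Fin n
    loopless : ∀ e → proj₁ (ends e) ≢ proj₂ (ends e)
    simple   : ∀ e e' u v → Joins (ends e) u v → Joins (ends e') u v → e ≡ e'
open Graph public

EdgeJoins : (G : Graph) → Fin (m G) → Fin (n G) → Fin (n G) → Set
EdgeJoins G e u v = Joins (ends G e) u v

Adjacent : (G : Graph) → Fin (n G) → Fin (n G) → Set
Adjacent G u v = ∃[ e ] EdgeJoins G e u v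

-- Subgraphs are identified with their edge sets (Subset (m G)).

EdgeSet : Graph → Set
EdgeSet G = Subset (m G)

incident : (G : Graph) → Fin (n G) → EdgeSet G
incident G u = tabulate (λ e → ⌊ proj₁ (ends G e) ≟ u ⌋ ∨ ⌊ proj₂ (ends G e) ≟ u ⌋)

degree : (G : Graph) → EdgeSet G → Fin (n G) → ℕ
degree G S u = ∣ S ∩ incident G u ∣

Eulerian : (G : Graph) → EdgeSet G → Set
Eulerian G S = ∀ u → 2 ∣ degree G S u

_⊕_ : ∀ {k} → Subset k → Subset k → Subset k
_⊕_ = zipWith _xor_

⊕-sum : ∀ {k} → List (Subset k) → Subset k
⊕-sum = foldr _⊕_ FS.⊥

weight : ∀ {k} → List (Subset k) → ℕ
weight B = sum (map ∣_∣ B)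

CycNext : ∀ {k} → Fin k → Fin k → Set
CycNext {k} i j = toℕ j ≡ suc (toℕ i) ⊎ (toℕ i ≡ k ∸ 1 × toℕ j ≡ 0)

record CycleIn (G : Graph) : Set where
  field
    len    : ℕ
    len≥3  : 3 ≤ len
    vtx    : Fin len → Fin (n G)
    vtx-inj : Injective _≡_ _≡_ vtx
    consec : ∀ i j → CycNext i j → Adjacent G (vtx i) (vtx j)
open CycleIn public

CycleEdge : (G : Graph) → CycleIn G → Fin (m G) → Set
CycleEdge G c e = ∃[ i ] ∃[ j ] (CycNext i j × EdgeJoins G e (vtx c i) (vtx c j))

HasEdges : (G : Graph) → CycleIn G → EdgeSet G → Set
HasEdges G c S = ∀ e → (e FS.∈ S) ⇔ CycleEdge G c e

IsCycle : (G : Graph) → EdgeSet G → Set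
IsCycle G S = Σ (CycleIn G) λ c → HasEdges G c S

Chordless : (G : Graph) → CycleIn G → Set
Chordless G c = ∀ i j → Adjacent G (vtx c i) (vtx c j) → CycNext i j ⊎ CycNext j i

IsInducedCycle : (G : Graph) → EdgeSet G → Set
IsInducedCycle G S = Σ (CycleIn G) λ c → HasEdges G c S × Chordless G c

-- Cycle bases. Finite sets of subgraphs are duplicate-free lists.

Generates : (G : Graph) → List (EdgeSet G) → Set
Generates G B = ∀ C → IsCycle G C → ∃[ B' ] (B' SL.⊆ B × C ≡ ⊕-sum B')

IsCycleBasis : (G : Graph) → List (EdgeSet G) → Set
IsCycleBasis G B =
  Unique B × All (Eulerian G) B × Generates G B ×
  (∀ B' → B' SL.⊆ B → length B' < length B → ¬ Generates G B')

IsMinimumCycleBasis : (G : Graph) → List (EdgeSet G) → Set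
IsMinimumCycleBasis G B =
  IsCycleBasis G B × (∀ B' → IsCycleBasis G B' → weight B ≤ weight B')

IsCycleGraph : Graph → Set
IsCycleGraph G = Σ (CycleIn G) λ c →
  Surjective _≡_ _≡_ (vtx c) × (∀ e → CycleEdge G c e)

-- H arises from G by adding a new path P of length L ≥ 2 between the
-- endpoints u, v of an edge of G, internally disjoint from G.
record PathExtension (G H : Graph) : Set where
  field
    φ     : Fin (n G) → Fin (n H)
    φ-inj : Injective _≡_ _≡_ φ
    ψ     : Fin (m G) → Fin (m H)
    ψ-inj : Injective _≡_ _≡_ ψ
    ψ-ends : ∀ e → ends H (ψ e) ≡ (φ (proj₁ (ends G e)) , φ (proj₂ (ends G e)))
    e₀    : Fin (m G)
    L     : ℕ
    L≥2   : 2 ≤ L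
    path  : Fin (suc L) → Fin (n H)
    path-inj : Injective _≡_ _≡_ path
    path-start : path Data.Fin.zero ≡ φ (proj₁ (ends G e₀))
    path-end   : path (Data.Fin.fromℕ L) ≡ φ (proj₂ (ends G e₀))
    path-new : ∀ i → 0 < toℕ i → toℕ i < L → ∀ x → path i ≢ φ x
    path-adj : ∀ i j → toℕ j ≡ suc (toℕ i) → Adjacent H (path i) (path j)
    vertices : ∀ w → (∃[ x ] w ≡ φ x) ⊎ (∃[ i ] w ≡ path i)
    edges : ∀ f → (∃[ e ] f ≡ ψ e) ⊎
                  (∃[ i ] ∃[ j ] (toℕ j ≡ suc (toℕ i) × EdgeJoins H f (path i) (path j)))

data Polygonal2Tree : Graph → Set where
  cycle : ∀ G → IsCycleGraph G → Polygonal2Tree G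
  addPath : ∀ G H → Polygonal2Tree G → PathExtension G H → Polygonal2Tree H

module Submission where

-- Induction along the construction of the polygonal 2-tree, carrying a FaceBasis: the induced cycles
-- (faces) span all Eulerian subgraphs, and every list B of Eulerian subgraphs generating the cycles has at
-- least as many nonempty members as there are faces and weight at least weight faces + 3 (#nonempty B − #faces),
-- where equality in both forces B to consist of the faces (and ∅). For a single cycle every Eulerian subgraph
-- is ∅ or the whole cycle. When a path P of length L is glued along an edge e₀ of G, the faces become
-- P + e₀ and the old faces. A generating list B of the new graph H is projected to G by adding P + e₀ to each
-- member using P; the projection still generates the cycles of G. Each member b using P satisfies
-- ∣b∣ + 3 [proj b ≠ ∅] = ∣proj b∣ + 3 + (L − 2) + s with s ∈ {0, 1, 3}, and s = 0 only for b = P + e₀, whose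
-- projection is ∅; summing over B and applying the invariant of G gives the invariant of H. For the rank
-- bound one projects along a member containing P instead, which then vanishes.

open import Defs
open import Data.Nat using (ℕ; zero; suc; _+_; _*_; _∸_; _≤_; _<_; _⊓_; z≤n; s≤s; _<?_; s≤s⁻¹)
open import Data.Nat.Properties hiding (_≟_)
open import Data.Nat.Divisibility using (_∣_; ∣1⇒≡1; _∣0; ∣-refl; ∣m+n∣m⇒∣n; ∣m∣n⇒∣m+n; m∣m*n)
open import Data.Nat.Tactic.RingSolver using (solve-∀)
open import Data.Nat.ListAction using (sum)
open import Data.Nat.ListAction.Properties using (sum-↭)
open import Data.Bool using (Bool; true; false; _∧_; _∨_; not; _xor_)
open import Data.Bool.Properties using (∧-identityʳ; ∧-zeroʳ; ∧-assoc; xor-assoc; xor-comm; xor-same; xor-identityʳ)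
open import Data.Fin using (Fin; zero; suc; toℕ; fromℕ; fromℕ<; inject₁; _≟_)
open import Data.Fin.Properties using (toℕ-injective; toℕ-fromℕ<; toℕ-fromℕ; toℕ-inject₁; toℕ<n; any?; injective⇒≤)
import Data.Fin.Properties as Finₚ
open import Data.Fin.Induction using (<-weakInduction)
open import Data.Fin.Subset as FS using (Subset; ∣_∣; ⁅_⁆; _∩_)
open import Data.Fin.Subset.Properties using (∣⊥∣≡0; ∣⊤∣≡n; ⊆⊤; ∣⁅x⁆∣≡1)
open import Data.Vec using (Vec; []; _∷_; lookup; tabulate)
open import Data.Vec.Properties using (tabulate∘lookup; tabulate-cong; lookup-zipWith; lookup-replicate; lookup∘tabulate; []=⇒lookup; lookup⇒[]=)
open import Data.List using (List; []; _∷_; map; length)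
open import Data.List.Properties using (length-map)
open import Data.List.Membership.Propositional using (_∈_)
open import Data.List.Membership.Propositional.Properties using (∈-map⁺; ∈-map⁻)
open import Data.List.Membership.Propositional.Properties.WithK using (unique∧set⇒bag)
open import Data.List.Relation.Binary.BagAndSetEquality using (∼bag⇒↭)
open import Data.List.Relation.Unary.Any using (here; there)
open import Data.List.Relation.Unary.All as All using (All; []; _∷_)
open import Data.List.Relation.Unary.All.Properties using () renaming (map⁺ to All-map⁺)
open import Data.List.Relation.Unary.AllPairs using ([]; _∷_)
open import Data.List.Relation.Unary.Unique.Propositional using (Unique)
import Data.List.Relation.Unary.Unique.Propositional.Properties as Unique
open import Data.List.Relation.Binary.Sublist.Propositional using (_⊆_; []; _∷_; _∷ʳ_; minimum; ⊆-refl)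
open import Data.List.Relation.Binary.Sublist.Propositional.Properties using (All-resp-⊆; Any-resp-⊆) renaming (map⁺ to ⊆-map⁺)
open import Data.List.Relation.Binary.Permutation.Propositional using (_↭_)
open import Data.List.Relation.Binary.Permutation.Propositional.Properties using (↭-length)
import Data.List.Relation.Binary.Permutation.Propositional.Properties as Perm
open import Data.Product using (∃-syntax; _×_; _,_; proj₁; proj₂)
open import Data.Product.Properties using (,-injective)
open import Data.Sum using (_⊎_; inj₁; inj₂)
open import Data.Empty using (⊥-elim)
open import Relation.Nullary using (¬_; yes; no; does)
open import Relation.Nullary.Decidable using (⌊_⌋; dec-true; dec-false; does-⇔)
open import Relation.Binary.PropositionalEquality
open import Function using (_∘_; _∘′_)
open import Function.Bundles using (_⇔_; mk⇔; Equivalence)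
open import Function.Definitions using (Injective)

-- Cyclic order on Fin k

next : ∀ {k} → Fin k → Fin k
next {suc k} i with suc (toℕ i) <? suc k
... | yes p = fromℕ< p
... | no _ = zero

prev : ∀ {k} → Fin k → Fin k
prev {suc k} zero = fromℕ k
prev {suc k} (suc j) = inject₁ j

suc-toℕ<⊎last : ∀ {k} (i : Fin k) → suc (toℕ i) < k ⊎ toℕ i ≡ k ∸ 1
suc-toℕ<⊎last {suc k} i with suc (toℕ i) <? suc k
... | yes p = inj₁ p
... | no ¬p = inj₂ (≤-antisym (s≤s⁻¹ (toℕ<n i)) (s≤s⁻¹ (≮⇒≥ ¬p)))

toℕ-next-< : ∀ {k} (i : Fin k) → suc (toℕ i) < k → toℕ (next i) ≡ suc (toℕ i)
toℕ-next-< {suc k} i q with suc (toℕ i) <? suc k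
... | yes p = toℕ-fromℕ< p
... | no ¬p = ⊥-elim (¬p q)

toℕ-next-last : ∀ {k} (i : Fin k) → toℕ i ≡ k ∸ 1 → toℕ (next i) ≡ 0
toℕ-next-last {suc k} i q with suc (toℕ i) <? suc k
... | yes p = ⊥-elim (<-irrefl refl (subst (λ z → suc z ≤ k) q (s≤s⁻¹ p)))
... | no _ = refl

CycNext-next : ∀ {k} (i : Fin k) → CycNext i (next i)
CycNext-next i with suc-toℕ<⊎last i
... | inj₁ p = inj₁ (toℕ-next-< i p)
... | inj₂ q = inj₂ (q , toℕ-next-last i q)

CycNext⇒≡next : ∀ {k} {i j : Fin k} → CycNext i j → j ≡ next i
CycNext⇒≡next {suc k} {i} {j} (inj₁ p) with suc-toℕ<⊎last i
... | inj₁ q = toℕ-injective (trans p (sym (toℕ-next-< i q)))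
... | inj₂ q = ⊥-elim (<-irrefl (trans p (cong suc q)) (toℕ<n j))
CycNext⇒≡next {i = i} (inj₂ (p , q)) = toℕ-injective (trans q (sym (toℕ-next-last i p)))

next-prev : ∀ {k} (j : Fin k) → next (prev j) ≡ j
next-prev {suc k} zero = toℕ-injective (toℕ-next-last (fromℕ k) (toℕ-fromℕ k))
next-prev {suc k} (suc j) = toℕ-injective (trans (toℕ-next-< (inject₁ j) lt) (cong suc (toℕ-inject₁ j)))
  where
  lt : suc (toℕ (inject₁ j)) < suc k
  lt = subst (λ z → suc z < suc k) (sym (toℕ-inject₁ j)) (toℕ<n (suc j))

next-injective : ∀ {k} → Injective _≡_ _≡_ (next {k})
next-injective {x = i} {j} e with suc-toℕ<⊎last i | suc-toℕ<⊎last j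
... | inj₁ p | inj₁ q =
  toℕ-injective (suc-injective (trans (sym (toℕ-next-< i p)) (trans (cong toℕ e) (toℕ-next-< j q))))
... | inj₁ p | inj₂ q with () ← trans (sym (toℕ-next-< i p)) (trans (cong toℕ e) (toℕ-next-last j q))
... | inj₂ p | inj₁ q with () ← trans (sym (toℕ-next-< j q)) (trans (cong toℕ (sym e)) (toℕ-next-last i p))
... | inj₂ p | inj₂ q = toℕ-injective (trans p (sym q))

CycNext⇒≡prev : ∀ {k} {i j : Fin k} → CycNext i j → i ≡ prev j
CycNext⇒≡prev {j = j} c = next-injective (trans (sym (CycNext⇒≡next c)) (sym (next-prev j)))

next²≢id : ∀ {k} → 3 ≤ k → (i : Fin k) → next (next i) ≢ i
next²≢id {k} 3≤k i e with suc-toℕ<⊎last i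
next²≢id {k} 3≤k i e | inj₁ p with suc-toℕ<⊎last (next i)
... | inj₁ q = n≢2+n (toℕ i) (trans (cong toℕ (sym e)) (trans (toℕ-next-< (next i) q) (cong suc (toℕ-next-< i p))))
  where n≢2+n : ∀ n → n ≢ suc (suc n)
        n≢2+n n eq = <-irrefl eq (≤-trans (n<1+n n) (n≤1+n (suc n)))
... | inj₂ q = <-irrefl (sym k∸1≡1) (≤-trans (s≤s (s≤s z≤n)) (∸-monoˡ-≤ 1 3≤k))
  where k∸1≡1 : k ∸ 1 ≡ 1
        k∸1≡1 = trans (sym q) (trans (toℕ-next-< i p)
                  (cong suc (trans (cong toℕ (sym e)) (toℕ-next-last (next i) q))))
next²≢id {k} 3≤k i e | inj₂ p = <-irrefl (sym k∸1≡1) (≤-trans (s≤s (s≤s z≤n)) (∸-monoˡ-≤ 1 3≤k))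
  where
  toℕ-next≡0 : toℕ (next i) ≡ 0
  toℕ-next≡0 = toℕ-next-last i p
  lt : suc (toℕ (next i)) < k
  lt = subst (λ z → suc z < k) (sym toℕ-next≡0) (≤-trans (s≤s (s≤s z≤n)) 3≤k)
  k∸1≡1 : k ∸ 1 ≡ 1
  k∸1≡1 = trans (sym p) (trans (cong toℕ (sym e)) (trans (toℕ-next-< (next i) lt) (cong suc toℕ-next≡0)))

constant-along-suc : ∀ {k} {A : Set} (f : Fin k → A) →
                     (∀ i j → toℕ j ≡ suc (toℕ i) → f i ≡ f j) → ∀ i j → f i ≡ f j
constant-along-suc {suc k} f step i j = trans (≡f₀ i) (sym (≡f₀ j))
  where
  ≡f₀ : ∀ i → f i ≡ f zero
  ≡f₀ = <-weakInduction (λ i → f i ≡ f zero) refl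
          (λ i p → trans (sym (step (inject₁ i) (suc i) (cong suc (sym (toℕ-inject₁ i))))) p)

-- Counting

bit : Bool → ℕ
bit true = 1
bit false = 0

count : ∀ {k} → (Fin k → Bool) → ℕ
count {zero} f = 0
count {suc k} f = bit (f zero) + count (f ∘ suc)

∣∣≡count : ∀ {k} (S : Subset k) → ∣ S ∣ ≡ count (lookup S)
∣∣≡count [] = refl
∣∣≡count (true ∷ S) = cong suc (∣∣≡count S)
∣∣≡count (false ∷ S) = ∣∣≡count S

count-cong : ∀ {k} {f g : Fin k → Bool} → (∀ e → f e ≡ g e) → count f ≡ count g
count-cong {zero} p = refl
count-cong {suc k} p = cong₂ _+_ (cong bit (p zero)) (count-cong (p ∘ suc))

count-false : ∀ {k} {f : Fin k → Bool} → (∀ e → f e ≡ false) → count f ≡ 0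
count-false {zero} p = refl
count-false {suc k} p rewrite p zero = count-false (p ∘ suc)

count-true : ∀ {k} {f : Fin k → Bool} → (∀ e → f e ≡ true) → count f ≡ k
count-true {zero} p = refl
count-true {suc k} p rewrite p zero = cong suc (count-true (p ∘ suc))

count-split : ∀ {k} (f g : Fin k → Bool) → count f ≡ count (λ e → f e ∧ g e) + count (λ e → f e ∧ not (g e))
count-split {zero} f g = refl
count-split {suc k} f g rewrite count-split (f ∘ suc) (g ∘ suc) with f zero | g zero
... | true | true = refl
... | true | false = sym (+-suc _ _)
... | false | true = refl
... | false | false = refl

count-remove : ∀ {k} (a : Fin k) (f : Fin k → Bool) → count f ≡ bit (f a) + count (λ e → f e ∧ not (does (e ≟ a)))
count-remove zero f = cong (bit (f zero) +_)
  (cong₂ (λ x y → bit x + y) (sym (∧-zeroʳ (f zero))) (count-cong λ e → sym (∧-identityʳ (f (suc e)))))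
count-remove (suc a) f = begin
  bit (f zero) + count (f ∘ suc)                 ≡⟨ cong (bit (f zero) +_) (count-remove a (f ∘ suc)) ⟩
  bit (f zero) + (bit (f (suc a)) + count rest)  ≡⟨ swap (bit (f zero)) (bit (f (suc a))) (count rest) ⟩
  bit (f (suc a)) + (bit (f zero) + count rest)  ≡⟨ cong (λ x → bit (f (suc a)) + (bit x + count rest)) (sym (∧-identityʳ (f zero))) ⟩
  bit (f (suc a)) + count (λ e → f e ∧ not (does (e ≟ suc a))) ∎
  where
  open ≡-Reasoning
  rest = λ e → f (suc e) ∧ not (does (e ≟ a))
  swap : ∀ x y z → x + (y + z) ≡ y + (x + z)
  swap = solve-∀

count-two : ∀ {k} (f : Fin k → Bool) {a b : Fin k} → a ≢ b → (∀ e → f e ≡ true → e ≡ a ⊎ e ≡ b) →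
            count f ≡ bit (f a) + bit (f b)
count-two f {a} {b} a≢b onlyab = begin
  count f                                                           ≡⟨ count-remove a f ⟩
  bit (f a) + count f-a                                             ≡⟨ cong (bit (f a) +_) (count-remove b f-a) ⟩
  bit (f a) + (bit (f-a b) + count (λ e → f-a e ∧ not (does (e ≟ b))))   ≡⟨ cong₂ (λ x y → bit (f a) + (bit x + y)) f-a-b (count-false none) ⟩
  bit (f a) + (bit (f b) + 0)                                        ≡⟨ cong (bit (f a) +_) (+-identityʳ _) ⟩
  bit (f a) + bit (f b)                                              ∎
  where
  open ≡-Reasoning
  f-a = λ e → f e ∧ not (does (e ≟ a))
  f-a-b : f-a b ≡ f b
  f-a-b = trans (cong (λ x → f b ∧ not x) (dec-false (b ≟ a) (a≢b ∘ sym))) (∧-identityʳ (f b))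
  none : ∀ e → f-a e ∧ not (does (e ≟ b)) ≡ false
  none e with f e in fe
  ... | false = refl
  ... | true with onlyab e fe
  ...   | inj₁ refl rewrite dec-true (a ≟ a) refl = refl
  ...   | inj₂ refl rewrite dec-true (b ≟ b) refl = ∧-zeroʳ _

count-xor : ∀ {k} (f g h : Fin k → Bool) →
  count (λ e → (f e xor g e) ∧ h e) + 2 * count (λ e → (f e ∧ g e) ∧ h e) ≡ count (λ e → f e ∧ h e) + count (λ e → g e ∧ h e)
count-xor {zero} f g h = refl
count-xor {suc k} f g h with count-xor (f ∘ suc) (g ∘ suc) (h ∘ suc)
... | ih with f zero | g zero | h zero
... | true  | true  | false = ih
... | true  | false | false = ih
... | false | true  | false = ih
... | false | false | false = ih
... | false | false | true = ih
... | true  | false | true = cong suc ih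
... | false | true  | true = trans (cong suc ih) (sym (+-suc _ _))
... | true  | true  | true = trans (lhs _ _) (trans (cong (2 +_) ih) (rhs _ _))
  where
  lhs : ∀ x y → x + 2 * (1 + y) ≡ 2 + (x + 2 * y)
  lhs = solve-∀
  rhs : ∀ x y → 2 + (x + y) ≡ (1 + x) + (1 + y)
  rhs = solve-∀

inImage : ∀ {a b} → (Fin a → Fin b) → Fin b → Bool
inImage ψ e = does (any? (λ x → ψ x ≟ e))

inImage-image : ∀ {a b} (ψ : Fin a → Fin b) x → inImage ψ (ψ x) ≡ true
inImage-image ψ x = dec-true (any? _) (x , refl)

inImage-suc : ∀ {a b} (ψ : Fin (suc a) → Fin b) → Injective _≡_ _≡_ ψ →
              ∀ e → inImage (ψ ∘ suc) e ≡ inImage ψ e ∧ not (does (e ≟ ψ zero))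
inImage-suc ψ ψ-inj e with e ≟ ψ zero
... | yes refl = trans (dec-false (any? λ x → ψ (suc x) ≟ ψ zero) (λ (x , p) → 0≢suc (ψ-inj p))) (sym (∧-zeroʳ _))
  where 0≢suc : ∀ {a} {x : Fin a} → suc x ≢ zero
        0≢suc ()
... | no e≢ψ₀ = trans (does-⇔ (mk⇔ (λ (x , p) → suc x , p) from) (any? λ x → ψ (suc x) ≟ e) (any? λ x → ψ x ≟ e)) (sym (∧-identityʳ _))
  where
  from : ∃[ x ] ψ x ≡ e → ∃[ x ] ψ (suc x) ≡ e
  from (zero , p) = ⊥-elim (e≢ψ₀ (sym p))
  from (suc x , p) = x , p

count-∘ : ∀ {a b} (ψ : Fin a → Fin b) → Injective _≡_ _≡_ ψ → (f : Fin b → Bool) →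
          count (f ∘ ψ) ≡ count (λ e → f e ∧ inImage ψ e)
count-∘ {zero} ψ ψ-inj f = sym (count-false λ e → trans (cong (f e ∧_) (dec-false (any? λ x → ψ x ≟ e) λ ())) (∧-zeroʳ (f e)))
count-∘ {suc a} ψ ψ-inj f = begin
  bit (f (ψ zero)) + count (f ∘ ψ ∘ suc)                            ≡⟨ cong (bit (f (ψ zero)) +_) (count-∘ (ψ ∘ suc) (Finₚ.suc-injective ∘ ψ-inj) f) ⟩
  bit (f (ψ zero)) + count (λ e → f e ∧ inImage (ψ ∘ suc) e)          ≡⟨ cong₂ (λ x y → bit x + y) (sym ψ₀∈) (count-cong λ e → cong (f e ∧_) (inImage-suc ψ ψ-inj e)) ⟩
  bit (f (ψ zero) ∧ inImage ψ (ψ zero)) + count (λ e → f e ∧ (inImage ψ e ∧ not (does (e ≟ ψ zero)))) ≡⟨ cong (bit (f (ψ zero) ∧ inImage ψ (ψ zero)) +_) (count-cong λ e → sym (∧-assoc (f e) _ _)) ⟩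
  bit (f (ψ zero) ∧ inImage ψ (ψ zero)) + count (λ e → (f e ∧ inImage ψ e) ∧ not (does (e ≟ ψ zero))) ≡⟨ sym (count-remove (ψ zero) (λ e → f e ∧ inImage ψ e)) ⟩
  count (λ e → f e ∧ inImage ψ e) ∎
  where
  open ≡-Reasoning
  ψ₀∈ : f (ψ zero) ∧ inImage ψ (ψ zero) ≡ f (ψ zero)
  ψ₀∈ = trans (cong (f (ψ zero) ∧_) (inImage-image ψ zero)) (∧-identityʳ _)

count-partition : ∀ {a b c} (ψ : Fin a → Fin c) (χ : Fin b → Fin c) →
                  Injective _≡_ _≡_ ψ → Injective _≡_ _≡_ χ → (∀ x y → ψ x ≢ χ y) →
                  (∀ e → (∃[ x ] e ≡ ψ x) ⊎ (∃[ y ] e ≡ χ y)) →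
                  ∀ f → count f ≡ count (f ∘ ψ) + count (f ∘ χ)
count-partition ψ χ ψ-inj χ-inj disjoint cover f = begin
  count f                                                                  ≡⟨ count-split f (inImage ψ) ⟩
  count (λ e → f e ∧ inImage ψ e) + count (λ e → f e ∧ not (inImage ψ e)) ≡⟨ cong₂ _+_ (sym (count-∘ ψ ψ-inj f)) (count-cong complement) ⟩
  count (f ∘ ψ) + count (λ e → f e ∧ inImage χ e)                         ≡⟨ cong (count (f ∘ ψ) +_) (sym (count-∘ χ χ-inj f)) ⟩
  count (f ∘ ψ) + count (f ∘ χ)                                            ∎
  where
  open ≡-Reasoning
  complement : ∀ e → f e ∧ not (inImage ψ e) ≡ f e ∧ inImage χ e
  complement e with cover e
  ... | inj₁ (x , refl) rewrite inImage-image ψ x | dec-false (any? (λ y → χ y ≟ ψ x)) (λ (y , p) → disjoint x y (sym p)) = refl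
  ... | inj₂ (y , refl) rewrite inImage-image χ y | dec-false (any? (λ x → ψ x ≟ χ y)) (λ (x , p) → disjoint x y p) = refl

-- Symmetric differences and spans

lookup-ext : ∀ {A : Set} {k} {S T : Vec A k} → (∀ e → lookup S e ≡ lookup T e) → S ≡ T
lookup-ext {S = S} {T} p = trans (sym (tabulate∘lookup S)) (trans (tabulate-cong p) (tabulate∘lookup T))

lookup-⊥ : ∀ {k} e → lookup (FS.⊥ {k}) e ≡ false
lookup-⊥ e = lookup-replicate e false

lookup-⁅⁆ : ∀ {k} (a e : Fin k) → lookup ⁅ a ⁆ e ≡ does (e ≟ a)
lookup-⁅⁆ zero zero = refl
lookup-⁅⁆ zero (suc e) = lookup-⊥ e
lookup-⁅⁆ (suc a) zero = refl
lookup-⁅⁆ (suc a) (suc e) = lookup-⁅⁆ a e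

module _ {k : ℕ} where

  lookup-⊕ : ∀ (S T : Subset k) e → lookup (S ⊕ T) e ≡ lookup S e xor lookup T e
  lookup-⊕ S T e = lookup-zipWith _xor_ e S T

  ⊕-assoc : ∀ (S T U : Subset k) → (S ⊕ T) ⊕ U ≡ S ⊕ (T ⊕ U)
  ⊕-assoc S T U = lookup-ext λ e → begin
    lookup ((S ⊕ T) ⊕ U) e                  ≡⟨ trans (lookup-⊕ (S ⊕ T) U e) (cong (_xor lookup U e) (lookup-⊕ S T e)) ⟩
    (lookup S e xor lookup T e) xor lookup U e ≡⟨ xor-assoc (lookup S e) (lookup T e) (lookup U e) ⟩
    lookup S e xor (lookup T e xor lookup U e) ≡⟨ sym (trans (lookup-⊕ S (T ⊕ U) e) (cong (lookup S e xor_) (lookup-⊕ T U e))) ⟩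
    lookup (S ⊕ (T ⊕ U)) e                  ∎
    where open ≡-Reasoning

  ⊕-comm : ∀ (S T : Subset k) → S ⊕ T ≡ T ⊕ S
  ⊕-comm S T = lookup-ext λ e →
    trans (lookup-⊕ S T e) (trans (xor-comm (lookup S e) (lookup T e)) (sym (lookup-⊕ T S e)))

  ⊕-self : ∀ (S : Subset k) → S ⊕ S ≡ FS.⊥
  ⊕-self S = lookup-ext λ e → trans (lookup-⊕ S S e) (trans (xor-same (lookup S e)) (sym (lookup-⊥ e)))

  ⊕-identityˡ : ∀ (S : Subset k) → FS.⊥ ⊕ S ≡ S
  ⊕-identityˡ S = lookup-ext λ e → trans (lookup-⊕ FS.⊥ S e) (cong (_xor lookup S e) (lookup-⊥ e))

  ⊕-identityʳ : ∀ (S : Subset k) → S ⊕ FS.⊥ ≡ S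
  ⊕-identityʳ S = trans (⊕-comm S FS.⊥) (⊕-identityˡ S)

  ⊕-cancelˡ : ∀ (S T : Subset k) → S ⊕ (S ⊕ T) ≡ T
  ⊕-cancelˡ S T = trans (sym (⊕-assoc S S T)) (trans (cong (_⊕ T) (⊕-self S)) (⊕-identityˡ T))

  ⊕-cancelʳ : ∀ (S T : Subset k) → (S ⊕ T) ⊕ T ≡ S
  ⊕-cancelʳ S T = trans (⊕-assoc S T T) (trans (cong (S ⊕_) (⊕-self T)) (⊕-identityʳ S))

  ⊕-left-comm : ∀ (S T U : Subset k) → S ⊕ (T ⊕ U) ≡ T ⊕ (S ⊕ U)
  ⊕-left-comm S T U = trans (sym (⊕-assoc S T U)) (trans (cong (_⊕ U) (⊕-comm S T)) (⊕-assoc T S U))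

  ⊕-interchange : ∀ (S T U V : Subset k) → (S ⊕ T) ⊕ (U ⊕ V) ≡ (S ⊕ U) ⊕ (T ⊕ V)
  ⊕-interchange S T U V =
    trans (⊕-assoc S T (U ⊕ V)) (trans (cong (S ⊕_) (⊕-left-comm T U V)) (sym (⊕-assoc S U (T ⊕ V))))

  data Span (P : Subset k → Set) : Subset k → Set where
    [] : Span P FS.⊥
    _∷_ : ∀ {x s} → P x → Span P s → Span P (x ⊕ s)

  Span-map : ∀ {P Q : Subset k → Set} → (∀ {x} → P x → Q x) → ∀ {s} → Span P s → Span Q s
  Span-map f [] = []
  Span-map f (px ∷ ps) = f px ∷ Span-map f ps

  ⊕-sum-toggle : ∀ {x} {I S : List (Subset k)} → x ∈ I → S ⊆ I → ∃[ S' ] (S' ⊆ I × ⊕-sum S' ≡ x ⊕ ⊕-sum S)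
  ⊕-sum-toggle (here refl) (y ∷ʳ r) = _ , (refl ∷ r) , refl
  ⊕-sum-toggle {x} (here refl) (_∷_ {xs = S} refl r) = S , (x ∷ʳ r) , sym (⊕-cancelˡ x (⊕-sum S))
  ⊕-sum-toggle (there p) (y ∷ʳ r) with ⊕-sum-toggle p r
  ... | S' , r' , eq = S' , (y ∷ʳ r') , eq
  ⊕-sum-toggle {x} (there p) (_∷_ {x = y} {xs = S} refl r) with ⊕-sum-toggle p r
  ... | S' , r' , eq = y ∷ S' , (refl ∷ r') , trans (cong (y ⊕_) eq) (⊕-left-comm y x (⊕-sum S))

  Span⇒⊕-sum : ∀ {I : List (Subset k)} {s} → Span (_∈ I) s → ∃[ S ] (S ⊆ I × s ≡ ⊕-sum S)
  Span⇒⊕-sum {I} [] = [] , minimum I , refl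
  Span⇒⊕-sum (px ∷ ps) with Span⇒⊕-sum ps
  ... | S , r , refl with ⊕-sum-toggle px r
  ...   | S' , r' , eq = S' , r' , sym eq

⊕-Homomorphism : ∀ {k k'} → (Subset k → Subset k') → Set
⊕-Homomorphism h = h FS.⊥ ≡ FS.⊥ × (∀ a b → h (a ⊕ b) ≡ h a ⊕ h b)

Span-hom : ∀ {k k'} {P : Subset k → Set} {Q : Subset k' → Set} {h : Subset k → Subset k'} → ⊕-Homomorphism h →
           (∀ {x} → P x → Q (h x)) → ∀ {s} → Span P s → Span Q (h s)
Span-hom (h-⊥ , h-⊕) f [] = subst (Span _) (sym h-⊥) []
Span-hom (h-⊥ , h-⊕) f (_∷_ {x} {s} px ps) = subst (Span _) (sym (h-⊕ x s)) (f px ∷ Span-hom (h-⊥ , h-⊕) f ps)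

⊕-sum-map : ∀ {k k'} {h : Subset k → Subset k'} → ⊕-Homomorphism h → ∀ S → ⊕-sum (map h S) ≡ h (⊕-sum S)
⊕-sum-map (h-⊥ , h-⊕) [] = sym h-⊥
⊕-sum-map (h-⊥ , h-⊕) (x ∷ S) = trans (cong (_ ⊕_) (⊕-sum-map (h-⊥ , h-⊕) S)) (sym (h-⊕ x (⊕-sum S)))

∈⊕-sum⇒∈member : ∀ {k} (S : List (Subset k)) e → lookup (⊕-sum S) e ≡ true → ∃[ x ] (x ∈ S × lookup x e ≡ true)
∈⊕-sum⇒∈member [] e e∈ with () ← trans (sym e∈) (lookup-⊥ e)
∈⊕-sum⇒∈member (x ∷ S) e e∈ with lookup x e in e∈x
... | true = x , here refl , e∈x
... | false with ∈⊕-sum⇒∈member S e (trans (sym (cong (_xor lookup (⊕-sum S) e) e∈x)) (trans (sym (lookup-⊕ x (⊕-sum S) e)) e∈))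
...   | y , y∈S , e∈y = y , there y∈S , e∈y

∈⇒0<∣∣ : ∀ {k} (S : Subset k) {e} → lookup S e ≡ true → 0 < ∣ S ∣
∈⇒0<∣∣ S {e} e∈S rewrite ∣∣≡count S | count-remove e (lookup S) | e∈S = s≤s z≤n

∣∣≡0⇒≡⊥ : ∀ {k} (S : Subset k) → ∣ S ∣ ≡ 0 → S ≡ FS.⊥
∣∣≡0⇒≡⊥ S ∣S∣≡0 = lookup-ext λ e → trans (∉S e) (sym (lookup-⊥ e))
  where
  ∉S : ∀ e → lookup S e ≡ false
  ∉S e with lookup S e in e∈S
  ... | false = refl
  ... | true = ⊥-elim (<-irrefl (sym ∣S∣≡0) (∈⇒0<∣∣ S e∈S))

∣⊕⁅⁆∣ : ∀ {k} (S : Subset k) a → ∣ S ⊕ ⁅ a ⁆ ∣ + bit (lookup S a) ≡ ∣ S ∣ + bit (not (lookup S a))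
∣⊕⁅⁆∣ S a = begin
  ∣ S ⊕ ⁅ a ⁆ ∣ + bit (lookup S a)                                       ≡⟨ cong (_+ bit (lookup S a)) (trans (∣∣≡count (S ⊕ ⁅ a ⁆)) (count-remove a _)) ⟩
  bit (lookup (S ⊕ ⁅ a ⁆) a) + count (rest (S ⊕ ⁅ a ⁆)) + bit (lookup S a) ≡⟨ cong₂ (λ x y → bit x + y + bit (lookup S a)) flip (count-cong same) ⟩
  bit (not (lookup S a)) + count (rest S) + bit (lookup S a)             ≡⟨ swap (bit (not (lookup S a))) (count (rest S)) (bit (lookup S a)) ⟩
  bit (lookup S a) + count (rest S) + bit (not (lookup S a))             ≡⟨ cong (_+ bit (not (lookup S a))) (sym (trans (∣∣≡count S) (count-remove a (lookup S)))) ⟩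
  ∣ S ∣ + bit (not (lookup S a))                                          ∎
  where
  open ≡-Reasoning
  rest : Subset _ → Fin _ → Bool
  rest T e = lookup T e ∧ not (does (e ≟ a))
  flip : lookup (S ⊕ ⁅ a ⁆) a ≡ not (lookup S a)
  flip rewrite lookup-⊕ S ⁅ a ⁆ a | lookup-⁅⁆ a a | dec-true (a ≟ a) refl = xor-comm (lookup S a) true
  same : ∀ e → rest (S ⊕ ⁅ a ⁆) e ≡ rest S e
  same e rewrite lookup-⊕ S ⁅ a ⁆ e | lookup-⁅⁆ a e with e ≟ a
  ... | yes _ = trans (∧-zeroʳ _) (sym (∧-zeroʳ _))
  ... | no _ = cong (_∧ true) (xor-identityʳ (lookup S e))
  swap : ∀ x y z → x + y + z ≡ z + y + x
  swap = solve-∀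

#nonempty : ∀ {k} → List (Subset k) → ℕ
#nonempty B = sum (map (λ b → 1 ⊓ ∣ b ∣) B)

#nonempty≤length : ∀ {k} (B : List (Subset k)) → #nonempty B ≤ length B
#nonempty≤length [] = z≤n
#nonempty≤length (b ∷ B) = +-mono-≤ (m⊓n≤m 1 ∣ b ∣) (#nonempty≤length B)

#nonempty≡0⇒⊕-sum≡⊥ : ∀ {k} (B S : List (Subset k)) → S ⊆ B → #nonempty B ≡ 0 → ⊕-sum S ≡ FS.⊥
#nonempty≡0⇒⊕-sum≡⊥ [] .[] [] _ = refl
#nonempty≡0⇒⊕-sum≡⊥ (b ∷ B) S r p with ∣ b ∣ in ∣b∣≡0
#nonempty≡0⇒⊕-sum≡⊥ (b ∷ B) S (.b ∷ʳ r) p | zero = #nonempty≡0⇒⊕-sum≡⊥ B S r p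
#nonempty≡0⇒⊕-sum≡⊥ (b ∷ B) (.b ∷ S) (refl ∷ r) p | zero =
  trans (cong₂ _⊕_ (∣∣≡0⇒≡⊥ b ∣b∣≡0) (#nonempty≡0⇒⊕-sum≡⊥ B S r p)) (⊕-self FS.⊥)

0<#nonempty⇒∃ : ∀ {k} (B : List (Subset k)) → 0 < #nonempty B → ∃[ b ] (b ∈ B × 0 < ∣ b ∣)
0<#nonempty⇒∃ (b ∷ B) p with ∣ b ∣ in ∣b∣≡
... | suc _ = b , here refl , subst (0 <_) (sym ∣b∣≡) (s≤s z≤n)
... | zero with 0<#nonempty⇒∃ B p
...   | b' , b'∈B , 0<∣b'∣ = b' , there b'∈B , 0<∣b'∣

drop-member : ∀ {A : Set} {x : A} {B : List A} → x ∈ B →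
              ∃[ B' ] (B' ⊆ B × length B' < length B × (∀ {y} → y ∈ B → y ≢ x → y ∈ B'))
drop-member {B = b ∷ B} (here refl) = B , (b ∷ʳ ⊆-refl) , ≤-refl , λ { (here refl) y≢x → ⊥-elim (y≢x refl) ; (there p) _ → p }
drop-member {B = b ∷ B} (there p) with drop-member p
... | B' , r , shorter , keeps = b ∷ B' , (refl ∷ r) , s≤s shorter , λ { (here refl) _ → here refl ; (there q) y≢x → there (keeps q y≢x) }

-- Graphs, degrees and cycles

Joins-sym : ∀ {k} {p : Fin k × Fin k} {a b} → Joins p a b → Joins p b a
Joins-sym (inj₁ q) = inj₂ q
Joins-sym (inj₂ q) = inj₁ q

Joins-unique : ∀ {k} {p : Fin k × Fin k} {a b c d} → Joins p a b → Joins p c d → (a ≡ c × b ≡ d) ⊎ (a ≡ d × b ≡ c)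
Joins-unique (inj₁ refl) (inj₁ q) = inj₁ (,-injective q)
Joins-unique (inj₁ refl) (inj₂ q) = inj₂ (,-injective q)
Joins-unique (inj₂ refl) (inj₁ q) = let (c≡b , d≡a) = ,-injective q in inj₂ (d≡a , c≡b)
Joins-unique (inj₂ refl) (inj₂ q) = let (d≡b , c≡a) = ,-injective q in inj₁ (c≡a , d≡b)

EdgeJoins⇒≢ : ∀ (G : Graph) {e a b} → EdgeJoins G e a b → a ≢ b
EdgeJoins⇒≢ G {e} (inj₁ q) refl = loopless G e (trans (cong proj₁ q) (sym (cong proj₂ q)))
EdgeJoins⇒≢ G {e} (inj₂ q) refl = loopless G e (trans (cong proj₁ q) (sym (cong proj₂ q)))

2∣bit+bit⇒≡ : ∀ x y → 2 ∣ bit x + bit y → x ≡ y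
2∣bit+bit⇒≡ true true _ = refl
2∣bit+bit⇒≡ false false _ = refl
2∣bit+bit⇒≡ true false 2∣1 with () ← ∣1⇒≡1 2∣1
2∣bit+bit⇒≡ false true 2∣1 with () ← ∣1⇒≡1 2∣1

module Incidence (G : Graph) where

  touches : Fin (n G) → Fin (m G) → Bool
  touches w e = lookup (incident G w) e

  degree≡count : ∀ T w → degree G T w ≡ count (λ e → lookup T e ∧ touches w e)
  degree≡count T w = trans (∣∣≡count (T ∩ incident G w)) (count-cong λ e → lookup-zipWith _∧_ e T (incident G w))

  touches-def : ∀ w e → touches w e ≡ ⌊ proj₁ (ends G e) ≟ w ⌋ ∨ ⌊ proj₂ (ends G e) ≟ w ⌋
  touches-def w e = lookup∘tabulate _ e

  touches⇒endpoint : ∀ {w e} → touches w e ≡ true → w ≡ proj₁ (ends G e) ⊎ w ≡ proj₂ (ends G e)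
  touches⇒endpoint {w} {e} h rewrite touches-def w e
    with proj₁ (ends G e) ≟ w | proj₂ (ends G e) ≟ w
  ... | yes p | _ = inj₁ (sym p)
  ... | no _ | yes q = inj₂ (sym q)
  touches⇒endpoint () | no _ | no _

  touches-proj₁ : ∀ e → touches (proj₁ (ends G e)) e ≡ true
  touches-proj₁ e rewrite touches-def (proj₁ (ends G e)) e
    with proj₁ (ends G e) ≟ proj₁ (ends G e)
  ... | yes _ = refl
  ... | no ¬p = ⊥-elim (¬p refl)

  touches-proj₂ : ∀ e → touches (proj₂ (ends G e)) e ≡ true
  touches-proj₂ e rewrite touches-def (proj₂ (ends G e)) e
    with proj₁ (ends G e) ≟ proj₂ (ends G e)
  ... | yes _ = refl
  ... | no _ with proj₂ (ends G e) ≟ proj₂ (ends G e)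
  ...   | yes _ = refl
  ...   | no ¬p = ⊥-elim (¬p refl)

  EdgeJoins⇒touches : ∀ {e a b} → EdgeJoins G e a b → touches a e ≡ true
  EdgeJoins⇒touches {e} (inj₁ q) = subst (λ w → touches w e ≡ true) (cong proj₁ q) (touches-proj₁ e)
  EdgeJoins⇒touches {e} (inj₂ q) = subst (λ w → touches w e ≡ true) (cong proj₂ q) (touches-proj₂ e)

  touches-EdgeJoins : ∀ {e a b w} → EdgeJoins G e a b → touches w e ≡ true → w ≡ a ⊎ w ≡ b
  touches-EdgeJoins (inj₁ q) h with touches⇒endpoint h
  ... | inj₁ p = inj₁ (trans p (cong proj₁ q))
  ... | inj₂ p = inj₂ (trans p (cong proj₂ q))
  touches-EdgeJoins (inj₂ q) h with touches⇒endpoint h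
  ... | inj₁ p = inj₂ (trans p (cong proj₁ q))
  ... | inj₂ p = inj₁ (trans p (cong proj₂ q))

  degree-two : ∀ T w {a b} → a ≢ b → (∀ e → lookup T e ≡ true → touches w e ≡ true → e ≡ a ⊎ e ≡ b) →
               touches w a ≡ true → touches w b ≡ true → degree G T w ≡ bit (lookup T a) + bit (lookup T b)
  degree-two T w {a} {b} a≢b only a∋w b∋w = begin
    degree G T w                                                ≡⟨ degree≡count T w ⟩
    count (λ e → lookup T e ∧ touches w e)                      ≡⟨ count-two _ a≢b only' ⟩
    bit (lookup T a ∧ touches w a) + bit (lookup T b ∧ touches w b) ≡⟨ cong₂ (λ x y → bit x + bit y) (restrict a∋w) (restrict b∋w) ⟩
    bit (lookup T a) + bit (lookup T b)                         ∎
    where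
    open ≡-Reasoning
    restrict : ∀ {e} → touches w e ≡ true → lookup T e ∧ touches w e ≡ lookup T e
    restrict h = trans (cong (lookup T _ ∧_) h) (∧-identityʳ _)
    only' : ∀ e → lookup T e ∧ touches w e ≡ true → e ≡ a ⊎ e ≡ b
    only' e h with lookup T e in e∈T | touches w e in e∋w
    only' e refl | true | true = only e e∈T e∋w

  Eulerian-⊥ : Eulerian G FS.⊥
  Eulerian-⊥ w = subst (2 ∣_) (sym (trans (degree≡count FS.⊥ w) (count-false λ e → cong (_∧ touches w e) (lookup-⊥ e)))) (2 ∣0)

  Eulerian-⊕ : ∀ {a b} → Eulerian G a → Eulerian G b → Eulerian G (a ⊕ b)
  Eulerian-⊕ {a} {b} a-even b-even w =
    ∣m+n∣m⇒∣n (subst (2 ∣_) (trans parity (+-comm (degree G (a ⊕ b) w) (2 * common))) (∣m∣n⇒∣m+n (a-even w) (b-even w))) (m∣m*n common)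
    where
    common = count (λ e → (lookup a e ∧ lookup b e) ∧ touches w e)
    parity : degree G a w + degree G b w ≡ degree G (a ⊕ b) w + 2 * common
    parity = sym (trans (cong (_+ 2 * common) (trans (degree≡count (a ⊕ b) w) (count-cong λ e → cong (_∧ touches w e) (lookup-⊕ a b e))))
                 (trans (count-xor (lookup a) (lookup b) (touches w)) (sym (cong₂ _+_ (degree≡count a w) (degree≡count b w)))))

module OnCycle (G : Graph) (c : CycleIn G) where
  open Incidence G

  private
    v = vtx c

  edge : Fin (len c) → Fin (m G)
  edge i = proj₁ (consec c i (next i) (CycNext-next i))

  edge-joins : ∀ i → EdgeJoins G (edge i) (v i) (v (next i))
  edge-joins i = proj₂ (consec c i (next i) (CycNext-next i))

  edge-CycleEdge : ∀ i → CycleEdge G c (edge i)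
  edge-CycleEdge i = i , next i , CycNext-next i , edge-joins i

  CycleEdge⇒edge : ∀ {e} → CycleEdge G c e → ∃[ i ] e ≡ edge i
  CycleEdge⇒edge {e} (i , j , i→j , joins) with CycNext⇒≡next i→j
  ... | refl = i , simple G e (edge i) (v i) (v (next i)) joins (edge-joins i)

  edge-injective : ∀ {i j} → edge i ≡ edge j → i ≡ j
  edge-injective {i} {j} p with Joins-unique (edge-joins i) (subst (λ e → EdgeJoins G e (v j) (v (next j))) (sym p) (edge-joins j))
  ... | inj₁ (vi≡vj , _) = vtx-inj c vi≡vj
  ... | inj₂ (vi≡vnj , vni≡vj) = ⊥-elim (next²≢id (len≥3 c) j (trans (cong next (sym (vtx-inj c vi≡vnj))) (vtx-inj c vni≡vj)))

  edge≢edge-prev : ∀ i → edge i ≢ edge (prev i)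
  edge≢edge-prev i p = next²≢id (len≥3 c) (prev i) (trans (cong next (next-prev i)) (trans (cong next i≡prev) (trans (next-prev i) i≡prev)))
    where i≡prev = edge-injective p

  i₀ : Fin (len c)
  i₀ = fromℕ< {0} (≤-trans (s≤s z≤n) (len≥3 c))

  module _ (S : Subset (m G)) (S-edges : HasEdges G c S) where

    ∈S⇒edge : ∀ {e} → lookup S e ≡ true → ∃[ i ] e ≡ edge i
    ∈S⇒edge h = CycleEdge⇒edge (Equivalence.to (S-edges _) (lookup⇒[]= _ S h))

    edge∈S : ∀ i → lookup S (edge i) ≡ true
    edge∈S i = []=⇒lookup (Equivalence.from (S-edges (edge i)) (edge-CycleEdge i))

    degree-on-cycle : ∀ T → T FS.⊆ S → ∀ i → degree G T (v i) ≡ bit (lookup T (edge i)) + bit (lookup T (edge (prev i)))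
    degree-on-cycle T T⊆S i =
      degree-two T (v i) (edge≢edge-prev i) only (EdgeJoins⇒touches (edge-joins i))
        (subst (λ w → touches w (edge (prev i)) ≡ true) (cong v (next-prev i)) (EdgeJoins⇒touches (Joins-sym (edge-joins (prev i)))))
      where
      only : ∀ e → lookup T e ≡ true → touches (v i) e ≡ true → e ≡ edge i ⊎ e ≡ edge (prev i)
      only e e∈T h with ∈S⇒edge ([]=⇒lookup (T⊆S (lookup⇒[]= e T e∈T)))
      ... | j , refl with touches-EdgeJoins (edge-joins j) h
      ...   | inj₁ vi≡vj = inj₁ (cong edge (vtx-inj c (sym vi≡vj)))
      ...   | inj₂ vi≡vnj = inj₂ (cong edge (CycNext⇒≡prev (subst (CycNext j) (vtx-inj c (sym vi≡vnj)) (CycNext-next j))))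

    degree-off-cycle : ∀ w → (∀ i → v i ≢ w) → degree G S w ≡ 0
    degree-off-cycle w off = trans (degree≡count S w) (count-false untouched)
      where
      untouched : ∀ e → lookup S e ∧ touches w e ≡ false
      untouched e with lookup S e in e∈S | touches w e in e∋w
      ... | false | _ = refl
      ... | true | false = refl
      ... | true | true with ∈S⇒edge e∈S
      ...   | j , refl with touches-EdgeJoins (edge-joins j) e∋w
      ...     | inj₁ p = ⊥-elim (off j (sym p))
      ...     | inj₂ p = ⊥-elim (off (next j) (sym p))

    Eulerian-cycle : Eulerian G S
    Eulerian-cycle w with any? (λ i → v i ≟ w)
    ... | yes (i , refl) = subst (2 ∣_) (sym (trans (degree-on-cycle S (λ p → p) i) (cong₂ (λ x y → bit x + bit y) (edge∈S i) (edge∈S (prev i))))) ∣-refl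
    ... | no off = subst (2 ∣_) (sym (degree-off-cycle w λ i p → off (i , p))) (2 ∣0)

    -- Consecutive cycle edges meet at a vertex of degree two within S, so evenness forces them to agree.
    Eulerian-⊆-cycle-constant : ∀ T → Eulerian G T → T FS.⊆ S → ∀ i j → lookup T (edge i) ≡ lookup T (edge j)
    Eulerian-⊆-cycle-constant T T-even T⊆S = constant-along-suc (λ i → lookup T (edge i)) λ i j j≡1+i →
      sym (2∣bit+bit⇒≡ _ _ (subst (2 ∣_) (trans (degree-on-cycle T T⊆S j)
        (cong (λ k → bit (lookup T (edge j)) + bit (lookup T (edge k))) (sym (CycNext⇒≡prev (inj₁ j≡1+i))))) (T-even (v j))))

    Eulerian-⊆-cycle : ∀ T → Eulerian G T → T FS.⊆ S → T ≡ FS.⊥ ⊎ T ≡ S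
    Eulerian-⊆-cycle T T-even T⊆S with lookup T (edge i₀) in e₀∈T
    ... | false = inj₁ (lookup-ext λ e → trans (∉T e) (sym (lookup-⊥ e)))
      where
      ∉T : ∀ e → lookup T e ≡ false
      ∉T e with lookup T e in e∈T
      ... | false = refl
      ... | true with ∈S⇒edge ([]=⇒lookup (T⊆S (lookup⇒[]= e T e∈T)))
      ...   | j , refl = trans (sym e∈T) (trans (Eulerian-⊆-cycle-constant T T-even T⊆S j i₀) e₀∈T)
    ... | true = inj₂ (lookup-ext T-agrees-S)
      where
      T-agrees-S : ∀ e → lookup T e ≡ lookup S e
      T-agrees-S e with lookup S e in e∈S
      ... | true with ∈S⇒edge e∈S
      ...   | j , refl = trans (Eulerian-⊆-cycle-constant T T-even T⊆S j i₀) e₀∈T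
      T-agrees-S e | false with lookup T e in e∈T
      ...   | false = refl
      ...   | true with () ← trans (sym ([]=⇒lookup (T⊆S (lookup⇒[]= e T e∈T)))) e∈S

IsCycle⇒Eulerian : ∀ {G S} → IsCycle G S → Eulerian G S
IsCycle⇒Eulerian {G} {S} (c , S-edges) = OnCycle.Eulerian-cycle G c S S-edges

IsCycle⇒0<∣∣ : ∀ {G S} → IsCycle G S → 0 < ∣ S ∣
IsCycle⇒0<∣∣ {G} {S} (c , S-edges) = ∈⇒0<∣∣ S (OnCycle.edge∈S G c S S-edges (OnCycle.i₀ G c))

-- Face bases

EulerianGenerating : (G : Graph) → List (EdgeSet G) → Set
EulerianGenerating G B = All (Eulerian G) B × Generates G B

record FaceBasis (G : Graph) : Set where
  field
    faces          : List (EdgeSet G)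
    faces-unique   : Unique faces
    ∈faces⇔induced : ∀ S → (S ∈ faces) ⇔ IsInducedCycle G S
    faces-span     : ∀ C → Eulerian G C → Span (_∈ faces) C
    faces≤#nonempty : ∀ B → EulerianGenerating G B → length faces ≤ #nonempty B
    weight-bound   : ∀ B → EulerianGenerating G B →
                     weight faces + 3 * #nonempty B ≤ weight B + 3 * length faces
    tight⇒faces    : ∀ B → EulerianGenerating G B → #nonempty B ≤ length faces → weight B ≤ weight faces →
                     (∀ b → b ∈ B → 0 < ∣ b ∣ → b ∈ faces) × (∀ F → F ∈ faces → F ∈ B)

  face-nonempty : ∀ {F} → F ∈ faces → 0 < ∣ F ∣
  face-nonempty {F} F∈ = let (c , edges , _) = Equivalence.to (∈faces⇔induced F) F∈ in IsCycle⇒0<∣∣ (c , edges)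

  faces-generate-within : ∀ {B} → (∀ {F} → F ∈ faces → F ∈ B) → Generates G B
  faces-generate-within faces⊆B C C-cycle = Span⇒⊕-sum (Span-map faces⊆B (faces-span C (IsCycle⇒Eulerian C-cycle)))

module MinimumBasis {G : Graph} (FB : FaceBasis G) (I : List (EdgeSet G)) (I-unique : Unique I)
                    (∈I⇔induced : ∀ S → (S ∈ I) ⇔ IsInducedCycle G S) where
  open FaceBasis FB

  ∈I⇔∈faces : ∀ S → (S ∈ I) ⇔ (S ∈ faces)
  ∈I⇔∈faces S = mk⇔ (Equivalence.from (∈faces⇔induced S) ∘′ Equivalence.to (∈I⇔induced S))
                    (Equivalence.from (∈I⇔induced S) ∘′ Equivalence.to (∈faces⇔induced S))

  I↭faces : I ↭ faces
  I↭faces = ∼bag⇒↭ (unique∧set⇒bag I-unique faces-unique λ {S} → ∈I⇔∈faces S)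

  length-I : length I ≡ length faces
  length-I = ↭-length I↭faces

  weight-I : weight I ≡ weight faces
  weight-I = sum-↭ (Perm.map⁺ ∣_∣ I↭faces)

  I-Eulerian : All (Eulerian G) I
  I-Eulerian = All.tabulate λ {S} S∈I → let (c , edges , _) = Equivalence.to (∈I⇔induced S) S∈I in IsCycle⇒Eulerian (c , edges)

  I-cycleBasis : IsCycleBasis G I
  I-cycleBasis = I-unique , I-Eulerian , faces-generate-within (Equivalence.from (∈I⇔∈faces _)) , minimal
    where
    minimal : ∀ B' → B' ⊆ I → length B' < length I → ¬ Generates G B'
    minimal B' B'⊆I shorter gen = <-irrefl refl (begin-strict
      length faces  ≤⟨ faces≤#nonempty B' (All-resp-⊆ B'⊆I I-Eulerian , gen) ⟩
      #nonempty B'  ≤⟨ #nonempty≤length B' ⟩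
      length B'     <⟨ shorter ⟩
      length I      ≡⟨ length-I ⟩
      length faces  ∎)
      where open ≤-Reasoning

  I-minimum : ∀ B → IsCycleBasis G B → weight I ≤ weight B
  I-minimum B (_ , B-Eulerian , B-gen , _) = subst (_≤ weight B) (sym weight-I)
    (+-cancelʳ-≤ (3 * length faces) (weight faces) (weight B) (begin
      weight faces + 3 * length faces ≤⟨ +-monoʳ-≤ (weight faces) (*-monoʳ-≤ 3 (faces≤#nonempty B (B-Eulerian , B-gen))) ⟩
      weight faces + 3 * #nonempty B  ≤⟨ weight-bound B (B-Eulerian , B-gen) ⟩
      weight B + 3 * length faces     ∎))
    where open ≤-Reasoning

  I-isMinimumCycleBasis : IsMinimumCycleBasis G I
  I-isMinimumCycleBasis = I-cycleBasis , I-minimum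

  -- A minimum basis cannot contain ∅: dropping it would leave a smaller generating list.
  minimum⇒∈⇔∈I : ∀ B → IsMinimumCycleBasis G B → ∀ S → (S ∈ B) ⇔ (S ∈ I)
  minimum⇒∈⇔∈I B ((_ , B-Eulerian , B-gen , B-minimal) , B-minimum) S = mk⇔ to from
    where
    weight-B≤ : weight B ≤ weight faces
    weight-B≤ = subst (weight B ≤_) weight-I (B-minimum I I-cycleBasis)
    #nonempty-B≤ : #nonempty B ≤ length faces
    #nonempty-B≤ = *-cancelˡ-≤ 3 (+-cancelˡ-≤ (weight faces) (3 * #nonempty B) (3 * length faces)
                     (≤-trans (weight-bound B (B-Eulerian , B-gen)) (+-monoˡ-≤ (3 * length faces) weight-B≤)))
    tight = tight⇒faces B (B-Eulerian , B-gen) #nonempty-B≤ weight-B≤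
    from : S ∈ I → S ∈ B
    from S∈I = proj₂ tight S (Equivalence.to (∈I⇔∈faces S) S∈I)
    to : S ∈ B → S ∈ I
    to S∈B with ∣ S ∣ in ∣S∣≡
    ... | suc _ = Equivalence.from (∈I⇔∈faces S) (proj₁ tight S S∈B (subst (0 <_) (sym ∣S∣≡) (s≤s z≤n)))
    ... | zero with drop-member S∈B
    ...   | B' , B'⊆B , shorter , keeps = ⊥-elim (B-minimal B' B'⊆B shorter (faces-generate-within λ {F} F∈ →
              keeps (proj₂ tight F F∈) λ { refl → <⇒≢ (face-nonempty F∈) (sym ∣S∣≡) }))

module CycleGraph (G : Graph) (isCycle : IsCycleGraph G) where
  private
    c = proj₁ isCycle
    all-edges = proj₂ (proj₂ isCycle)
  open OnCycle G c

  ⊤-edges : HasEdges G c FS.⊤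
  ⊤-edges e = mk⇔ (λ _ → all-edges e) (λ _ → lookup⇒[]= e FS.⊤ (lookup-replicate e true))

  3≤m : 3 ≤ m G
  3≤m = ≤-trans (len≥3 c) (injective⇒≤ edge-injective)

  c-chordless : Chordless G c
  c-chordless i j (e , joins) with CycleEdge⇒edge (all-edges e)
  ... | l , refl with Joins-unique (edge-joins l) joins
  ...   | inj₁ (vl≡vi , vnl≡vj) = inj₁ (subst₂ CycNext (vtx-inj c vl≡vi) (vtx-inj c vnl≡vj) (CycNext-next l))
  ...   | inj₂ (vl≡vj , vnl≡vi) = inj₂ (subst₂ CycNext (vtx-inj c vl≡vj) (vtx-inj c vnl≡vi) (CycNext-next l))

  Eulerian⇒⊥⊎⊤ : ∀ {T} → Eulerian G T → T ≡ FS.⊥ ⊎ T ≡ FS.⊤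
  Eulerian⇒⊥⊎⊤ {T} T-even = Eulerian-⊆-cycle FS.⊤ ⊤-edges T T-even ⊆⊤

  weight≡m*#nonempty : ∀ B → All (Eulerian G) B → weight B ≡ m G * #nonempty B
  weight≡m*#nonempty [] [] = sym (*-zeroʳ (m G))
  weight≡m*#nonempty (b ∷ B) (b-even ∷ B-even) with Eulerian⇒⊥⊎⊤ {b} b-even
  ... | inj₁ refl rewrite ∣⊥∣≡0 (m G) = weight≡m*#nonempty B B-even
  ... | inj₂ refl rewrite ∣⊤∣≡n (m G) | m≤n⇒m⊓n≡m (≤-trans (s≤s z≤n) 3≤m) =
    trans (cong (m G +_) (weight≡m*#nonempty B B-even)) (sym (*-suc (m G) (#nonempty B)))

  1≤#nonempty : ∀ B → Generates G B → 1 ≤ #nonempty B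
  1≤#nonempty B gen with #nonempty B in #B≡0 | gen FS.⊤ (c , ⊤-edges)
  ... | suc _ | _ = s≤s z≤n
  ... | zero | S , S⊆B , ⊤≡ΣS = ⊥-elim (⊤≢⊥ (trans ⊤≡ΣS (#nonempty≡0⇒⊕-sum≡⊥ B S S⊆B #B≡0)))
    where
    ⊤≢⊥ : FS.⊤ ≢ FS.⊥ {m G}
    ⊤≢⊥ p with () ← ≤-trans 3≤m (≤-reflexive (trans (sym (∣⊤∣≡n (m G))) (trans (cong ∣_∣ p) (∣⊥∣≡0 (m G)))))

  induced⇒⊤ : ∀ {S} → IsInducedCycle G S → S ∈ FS.⊤ ∷ []
  induced⇒⊤ {S} (c' , edges , _) with Eulerian⇒⊥⊎⊤ {S} (IsCycle⇒Eulerian (c' , edges))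
  ... | inj₂ S≡⊤ = here S≡⊤
  ... | inj₁ refl = ⊥-elim (<-irrefl (sym (∣⊥∣≡0 (m G))) (IsCycle⇒0<∣∣ (c' , edges)))

  ⊤-span : ∀ {C} → Eulerian G C → Span (_∈ FS.⊤ ∷ []) C
  ⊤-span {C} C-even with Eulerian⇒⊥⊎⊤ {C} C-even
  ... | inj₁ refl = []
  ... | inj₂ refl = subst (Span _) (⊕-identityʳ FS.⊤) (here refl ∷ [])

  ⊤-weight-bound : ∀ B → EulerianGenerating G B → weight (FS.⊤ {m G} ∷ []) + 3 * #nonempty B ≤ weight B + 3 * 1
  ⊤-weight-bound B (B-even , gen) = subst₂ _≤_ (cong (λ x → x + 0 + 3 * #nonempty B) (sym (∣⊤∣≡n (m G))))
    (cong (_+ 3 * 1) (sym (weight≡m*#nonempty B B-even))) (arith (m G) (#nonempty B) 3≤m (1≤#nonempty B gen))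
    where
    arith : ∀ m ν → 3 ≤ m → 1 ≤ ν → m + 0 + 3 * ν ≤ m * ν + 3 * 1
    arith m (suc t) 3≤m _ = subst₂ _≤_ (lhs m t) (rhs m t) (+-monoʳ-≤ (m + 3) (*-monoˡ-≤ t 3≤m))
      where
      lhs : ∀ m t → (m + 3) + 3 * t ≡ m + 0 + 3 * suc t
      lhs = solve-∀
      rhs : ∀ m t → (m + 3) + m * t ≡ m * suc t + 3 * 1
      rhs = solve-∀

  nonempty⇒⊤ : ∀ {B} → All (Eulerian G) B → ∀ b → b ∈ B → 0 < ∣ b ∣ → b ∈ FS.⊤ ∷ []
  nonempty⇒⊤ B-even b b∈B 0<∣b∣ with Eulerian⇒⊥⊎⊤ {b} (All.lookup B-even b∈B)
  ... | inj₂ b≡⊤ = here b≡⊤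
  ... | inj₁ refl = ⊥-elim (<-irrefl (sym (∣⊥∣≡0 (m G))) 0<∣b∣)

  ⊤∈ : ∀ B → EulerianGenerating G B → FS.⊤ ∈ B
  ⊤∈ B (B-even , gen) with 0<#nonempty⇒∃ B (1≤#nonempty B gen)
  ... | b , b∈B , 0<∣b∣ with nonempty⇒⊤ B-even b b∈B 0<∣b∣
  ...   | here refl = b∈B

  faceBasis : FaceBasis G
  faceBasis = record
    { faces = FS.⊤ ∷ []
    ; faces-unique = [] ∷ []
    ; ∈faces⇔induced = λ S → mk⇔ (λ { (here refl) → c , ⊤-edges , c-chordless }) induced⇒⊤
    ; faces-span = λ C → ⊤-span {C}
    ; faces≤#nonempty = λ B (_ , gen) → 1≤#nonempty B gen
    ; weight-bound = ⊤-weight-bound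
    ; tight⇒faces = λ B B-gen _ _ → nonempty⇒⊤ (proj₁ B-gen) , λ { F (here refl) → ⊤∈ B B-gen }
    }

-- Gluing a path along an edge

module Extension {G H : Graph} (ext : PathExtension G H) where
  open PathExtension ext
  module IG = Incidence G
  module IH = Incidence H

  pathEdge-adj : ∀ (i : Fin L) → Adjacent H (path (inject₁ i)) (path (suc i))
  pathEdge-adj i = path-adj (inject₁ i) (suc i) (cong suc (sym (toℕ-inject₁ i)))

  pathEdge : Fin L → Fin (m H)
  pathEdge i = proj₁ (pathEdge-adj i)

  pathEdge-joins : ∀ i → EdgeJoins H (pathEdge i) (path (inject₁ i)) (path (suc i))
  pathEdge-joins i = proj₂ (pathEdge-adj i)

  Inner : Fin (suc L) → Set
  Inner j = 0 < toℕ j × toℕ j < L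

  inner-new : ∀ {j x} → Inner j → path j ≢ φ x
  inner-new (0<j , j<L) = path-new _ 0<j j<L _

  pathEdge-inner : ∀ i → Inner (inject₁ i) ⊎ Inner (suc i)
  pathEdge-inner i with toℕ i in toℕi≡
  ... | zero = inj₂ (s≤s z≤n , L≥2)
  ... | suc _ = inj₁ (subst (0 <_) (sym (trans (toℕ-inject₁ i) toℕi≡)) (s≤s z≤n) , subst (_< L) (sym (toℕ-inject₁ i)) (toℕ<n i))

  path-endpoint : ∀ i {x} → path i ≡ φ x → toℕ i ≡ 0 ⊎ toℕ i ≡ L
  path-endpoint i p with toℕ i in toℕi≡
  ... | zero = inj₁ refl
  ... | suc t with suc t <? L
  ...   | yes t<L = ⊥-elim (inner-new (subst (0 <_) (sym toℕi≡) (s≤s z≤n) , subst (_< L) (sym toℕi≡) t<L) p)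
  ...   | no t≮L = inj₂ (≤-antisym (subst (_≤ L) toℕi≡ (s≤s⁻¹ (toℕ<n i))) (≮⇒≥ t≮L))

  ψ-joins : ∀ {e a b} → EdgeJoins G e a b → EdgeJoins H (ψ e) (φ a) (φ b)
  ψ-joins {e} (inj₁ q) = inj₁ (trans (ψ-ends e) (cong (λ p → φ (proj₁ p) , φ (proj₂ p)) q))
  ψ-joins {e} (inj₂ q) = inj₂ (trans (ψ-ends e) (cong (λ p → φ (proj₁ p) , φ (proj₂ p)) q))

  ψ-endpoints : ∀ e {w w'} → EdgeJoins H (ψ e) w w' → (∃[ x ] w ≡ φ x) × (∃[ y ] w' ≡ φ y)
  ψ-endpoints e (inj₁ q) = let (w≡ , w'≡) = ,-injective (trans (sym q) (ψ-ends e)) in (_ , w≡) , (_ , w'≡)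
  ψ-endpoints e (inj₂ q) = let (w'≡ , w≡) = ,-injective (trans (sym q) (ψ-ends e)) in (_ , w≡) , (_ , w'≡)

  ψ≢pathEdge : ∀ e i → ψ e ≢ pathEdge i
  ψ≢pathEdge e i p with ψ-endpoints e (subst (λ f → EdgeJoins H f _ _) (sym p) (pathEdge-joins i)) | pathEdge-inner i
  ... | (_ , start) , _ | inj₁ inner = inner-new inner start
  ... | _ , (_ , end) | inj₂ inner = inner-new inner end

  edge-cases : ∀ f → (∃[ e ] f ≡ ψ e) ⊎ (∃[ i ] f ≡ pathEdge i)
  edge-cases f with edges f
  ... | inj₁ old = inj₁ old
  ... | inj₂ (i' , j' , j'≡1+i' , joins) =
    inj₂ (i , simple H f (pathEdge i) (path i') (path j') joins
           (subst₂ (EdgeJoins H (pathEdge i)) (cong path inject₁i≡i') (cong path suci≡j') (pathEdge-joins i)))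
    where
    i'<L : toℕ i' < L
    i'<L = subst (_≤ L) j'≡1+i' (s≤s⁻¹ (toℕ<n j'))
    i : Fin L
    i = fromℕ< i'<L
    inject₁i≡i' : inject₁ i ≡ i'
    inject₁i≡i' = toℕ-injective (trans (toℕ-inject₁ i) (toℕ-fromℕ< i'<L))
    suci≡j' : suc i ≡ j'
    suci≡j' = toℕ-injective (trans (cong suc (toℕ-fromℕ< i'<L)) (sym j'≡1+i'))

  pathEdge-injective : ∀ {i j} → pathEdge i ≡ pathEdge j → i ≡ j
  pathEdge-injective {i} {j} p with Joins-unique (pathEdge-joins i) (subst (λ f → EdgeJoins H f _ _) (sym p) (pathEdge-joins j))
  ... | inj₁ (same , _) = toℕ-injective (trans (sym (toℕ-inject₁ i)) (trans (cong toℕ (path-inj same)) (toℕ-inject₁ j)))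
  ... | inj₂ (i≡1+j , 1+i≡j) = ⊥-elim (<-irrefl refl (begin-strict
        toℕ j      <⟨ n<1+n (toℕ j) ⟩
        suc (toℕ j) ≡⟨ sym (trans (sym (toℕ-inject₁ i)) (cong toℕ (path-inj i≡1+j))) ⟩
        toℕ i      <⟨ n<1+n (toℕ i) ⟩
        suc (toℕ i) ≡⟨ trans (cong toℕ (path-inj 1+i≡j)) (toℕ-inject₁ j) ⟩
        toℕ j      ∎))
    where open ≤-Reasoning

  EdgeJoins-φ⁻¹ : ∀ {f a b} → EdgeJoins H f (φ a) (φ b) → ∃[ e ] (f ≡ ψ e × EdgeJoins G e a b)
  EdgeJoins-φ⁻¹ {f} joins with edge-cases f
  ... | inj₂ (i , refl) with Joins-unique (pathEdge-joins i) joins | pathEdge-inner i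
  ...   | inj₁ (start , _) | inj₁ inner = ⊥-elim (inner-new inner start)
  ...   | inj₁ (_ , end) | inj₂ inner = ⊥-elim (inner-new inner end)
  ...   | inj₂ (start , _) | inj₁ inner = ⊥-elim (inner-new inner start)
  ...   | inj₂ (_ , end) | inj₂ inner = ⊥-elim (inner-new inner end)
  EdgeJoins-φ⁻¹ joins | inj₁ (e , refl) with joins
  ... | inj₁ q = let (a≡ , b≡) = ,-injective (trans (sym (ψ-ends e)) q) in e , refl , inj₁ (cong₂ _,_ (φ-inj a≡) (φ-inj b≡))
  ... | inj₂ q = let (b≡ , a≡) = ,-injective (trans (sym (ψ-ends e)) q) in e , refl , inj₂ (cong₂ _,_ (φ-inj b≡) (φ-inj a≡))

  Adjacent-φ : ∀ {a b} → Adjacent G a b → Adjacent H (φ a) (φ b)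
  Adjacent-φ (e , joins) = ψ e , ψ-joins joins

  Adjacent-φ⁻¹ : ∀ {a b} → Adjacent H (φ a) (φ b) → Adjacent G a b
  Adjacent-φ⁻¹ (_ , joins) = let (e , _ , joins') = EdgeJoins-φ⁻¹ joins in e , joins'

  touches-ψ : ∀ x e → IH.touches (φ x) (ψ e) ≡ IG.touches x e
  touches-ψ x e = begin
    IH.touches (φ x) (ψ e)                                        ≡⟨ IH.touches-def (φ x) (ψ e) ⟩
    ⌊ proj₁ (ends H (ψ e)) ≟ φ x ⌋ ∨ ⌊ proj₂ (ends H (ψ e)) ≟ φ x ⌋ ≡⟨ cong (λ p → ⌊ proj₁ p ≟ φ x ⌋ ∨ ⌊ proj₂ p ≟ φ x ⌋) (ψ-ends e) ⟩
    ⌊ φ (proj₁ (ends G e)) ≟ φ x ⌋ ∨ ⌊ φ (proj₂ (ends G e)) ≟ φ x ⌋ ≡⟨ cong₂ _∨_ (φ-reflects _ x) (φ-reflects _ x) ⟩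
    ⌊ proj₁ (ends G e) ≟ x ⌋ ∨ ⌊ proj₂ (ends G e) ≟ x ⌋           ≡⟨ sym (IG.touches-def x e) ⟩
    IG.touches x e                                                 ∎
    where
    open ≡-Reasoning
    φ-reflects : ∀ a x → ⌊ φ a ≟ φ x ⌋ ≡ ⌊ a ≟ x ⌋
    φ-reflects a x with a ≟ x | φ a ≟ φ x
    ... | yes refl | yes _ = refl
    ... | yes refl | no φa≢φa = ⊥-elim (φa≢φa refl)
    ... | no a≢x | yes φa≡φx = ⊥-elim (a≢x (φ-inj φa≡φx))
    ... | no _ | no _ = refl

  pull : Subset (m H) → Subset (m G)
  pull S = tabulate (lookup S ∘ ψ)

  lookup-pull : ∀ S e → lookup (pull S) e ≡ lookup S (ψ e)
  lookup-pull S e = lookup∘tabulate _ e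

  push-at : Subset (m G) → Fin (m H) → Bool
  push-at T f with edge-cases f
  ... | inj₁ (e , _) = lookup T e
  ... | inj₂ _ = false

  push : Subset (m G) → Subset (m H)
  push T = tabulate (push-at T)

  lookup-push-ψ : ∀ T e → lookup (push T) (ψ e) ≡ lookup T e
  lookup-push-ψ T e = trans (lookup∘tabulate _ (ψ e)) at-ψ
    where
    at-ψ : push-at T (ψ e) ≡ lookup T e
    at-ψ with edge-cases (ψ e)
    ... | inj₁ (e' , p) = cong (lookup T) (ψ-inj (sym p))
    ... | inj₂ (i , p) = ⊥-elim (ψ≢pathEdge e i p)

  PathFree : Subset (m H) → Set
  PathFree S = ∀ i → lookup S (pathEdge i) ≡ false

  push-PathFree : ∀ T → PathFree (push T)
  push-PathFree T i = trans (lookup∘tabulate _ (pathEdge i)) at-path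
    where
    at-path : push-at T (pathEdge i) ≡ false
    at-path with edge-cases (pathEdge i)
    ... | inj₁ (e , p) = ⊥-elim (ψ≢pathEdge e i (sym p))
    ... | inj₂ _ = refl

  ≡-by-cases : ∀ {S T : Subset (m H)} → (∀ e → lookup S (ψ e) ≡ lookup T (ψ e)) →
               (∀ i → lookup S (pathEdge i) ≡ lookup T (pathEdge i)) → S ≡ T
  ≡-by-cases {S} {T} old new = lookup-ext λ f → by (edge-cases f)
    where
    by : ∀ {f} → (∃[ e ] f ≡ ψ e) ⊎ (∃[ i ] f ≡ pathEdge i) → lookup S f ≡ lookup T f
    by (inj₁ (e , refl)) = old e
    by (inj₂ (i , refl)) = new i

  pull-push : ∀ T → pull (push T) ≡ T
  pull-push T = lookup-ext λ e → trans (lookup-pull (push T) e) (lookup-push-ψ T e)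

  push-pull : ∀ S → PathFree S → push (pull S) ≡ S
  push-pull S S-free = ≡-by-cases (λ e → trans (lookup-push-ψ (pull S) e) (lookup-pull S e))
                                  (λ i → trans (push-PathFree (pull S) i) (sym (S-free i)))

  push-injective : ∀ {T T'} → push T ≡ push T' → T ≡ T'
  push-injective {T} {T'} p = trans (sym (pull-push T)) (trans (cong pull p) (pull-push T'))

  pull-⊕ : ∀ S T → pull (S ⊕ T) ≡ pull S ⊕ pull T
  pull-⊕ S T = lookup-ext λ e → trans (lookup-pull (S ⊕ T) e) (trans (lookup-⊕ S T (ψ e))
    (sym (trans (lookup-⊕ (pull S) (pull T) e) (cong₂ _xor_ (lookup-pull S e) (lookup-pull T e)))))

  pull-⊥ : pull FS.⊥ ≡ FS.⊥
  pull-⊥ = lookup-ext λ e → trans (lookup-pull FS.⊥ e) (trans (lookup-⊥ (ψ e)) (sym (lookup-⊥ e)))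

  push-⊕ : ∀ S T → push (S ⊕ T) ≡ push S ⊕ push T
  push-⊕ S T = ≡-by-cases
    (λ e → trans (lookup-push-ψ (S ⊕ T) e) (trans (lookup-⊕ S T e)
             (sym (trans (lookup-⊕ (push S) (push T) (ψ e)) (cong₂ _xor_ (lookup-push-ψ S e) (lookup-push-ψ T e))))))
    (λ i → trans (push-PathFree (S ⊕ T) i)
             (sym (trans (lookup-⊕ (push S) (push T) (pathEdge i)) (cong₂ _xor_ (push-PathFree S i) (push-PathFree T i)))))

  push-⊥ : push FS.⊥ ≡ FS.⊥
  push-⊥ = ≡-by-cases (λ e → trans (lookup-push-ψ FS.⊥ e) (trans (lookup-⊥ e) (sym (lookup-⊥ (ψ e)))))
                      (λ i → trans (push-PathFree FS.⊥ i) (sym (lookup-⊥ (pathEdge i))))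

  count-by-cases : ∀ f → count f ≡ count (f ∘ ψ) + count (f ∘ pathEdge)
  count-by-cases = count-partition ψ pathEdge ψ-inj pathEdge-injective ψ≢pathEdge edge-cases

  ∣∣-by-cases : ∀ S → ∣ S ∣ ≡ ∣ pull S ∣ + count (lookup S ∘ pathEdge)
  ∣∣-by-cases S = trans (∣∣≡count S) (trans (count-by-cases (lookup S))
    (cong (_+ count (lookup S ∘ pathEdge)) (sym (trans (∣∣≡count (pull S)) (count-cong (lookup-pull S))))))

  ∣∣-PathFree : ∀ S → PathFree S → ∣ S ∣ ≡ ∣ pull S ∣
  ∣∣-PathFree S S-free = trans (∣∣-by-cases S) (trans (cong (∣ pull S ∣ +_) (count-false S-free)) (+-identityʳ _))

  ∣∣-PathFull : ∀ S → (∀ i → lookup S (pathEdge i) ≡ true) → ∣ S ∣ ≡ ∣ pull S ∣ + L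
  ∣∣-PathFull S S-full = trans (∣∣-by-cases S) (cong (∣ pull S ∣ +_) (count-true S-full))

  ∣push∣ : ∀ T → ∣ push T ∣ ≡ ∣ T ∣
  ∣push∣ T = trans (∣∣-PathFree (push T) (push-PathFree T)) (cong ∣_∣ (pull-push T))

  degree-pull : ∀ S → PathFree S → ∀ x → degree G (pull S) x ≡ degree H S (φ x)
  degree-pull S S-free x = sym (begin
    degree H S (φ x)                                                    ≡⟨ IH.degree≡count S (φ x) ⟩
    count (λ f → lookup S f ∧ IH.touches (φ x) f)                        ≡⟨ count-by-cases _ ⟩
    count (λ e → lookup S (ψ e) ∧ IH.touches (φ x) (ψ e)) + count (λ i → lookup S (pathEdge i) ∧ IH.touches (φ x) (pathEdge i))
      ≡⟨ cong₂ _+_ (count-cong λ e → cong₂ _∧_ (sym (lookup-pull S e)) (touches-ψ x e)) (count-false λ i → cong (_∧ _) (S-free i)) ⟩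
    count (λ e → lookup (pull S) e ∧ IG.touches x e) + 0                ≡⟨ +-identityʳ _ ⟩
    count (λ e → lookup (pull S) e ∧ IG.touches x e)                    ≡⟨ sym (IG.degree≡count (pull S) x) ⟩
    degree G (pull S) x                                                 ∎)
    where open ≡-Reasoning

  Eulerian-pull : ∀ S → PathFree S → Eulerian H S → Eulerian G (pull S)
  Eulerian-pull S S-free S-even x = subst (2 ∣_) (sym (degree-pull S S-free x)) (S-even (φ x))

  -- Inner path vertices have degree two in H, so an Eulerian subgraph contains all path edges or none.
  Eulerian-path-constant : ∀ b → Eulerian H b → ∀ i j → lookup b (pathEdge i) ≡ lookup b (pathEdge j)
  Eulerian-path-constant b b-even = constant-along-suc (lookup b ∘ pathEdge) step
    where
    step : ∀ i i' → toℕ i' ≡ suc (toℕ i) → lookup b (pathEdge i) ≡ lookup b (pathEdge i')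
    step i i' i'≡1+i = 2∣bit+bit⇒≡ _ _ (subst (2 ∣_) (IH.degree-two b w i≢i' only (IH.EdgeJoins⇒touches (Joins-sym (pathEdge-joins i))) w-touches-i') (b-even w))
      where
      w = path (suc i)
      inner-w : Inner (suc i)
      inner-w = s≤s z≤n , subst (_< L) i'≡1+i (toℕ<n i')
      w≡ : path (inject₁ i') ≡ w
      w≡ = cong path (toℕ-injective (trans (toℕ-inject₁ i') i'≡1+i))
      w-touches-i' : IH.touches w (pathEdge i') ≡ true
      w-touches-i' = subst (λ v → IH.touches v (pathEdge i') ≡ true) w≡ (IH.EdgeJoins⇒touches (pathEdge-joins i'))
      i≢i' : pathEdge i ≢ pathEdge i'
      i≢i' p = 1+n≢n (sym (trans (cong toℕ (pathEdge-injective p)) i'≡1+i))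
      only : ∀ f → lookup b f ≡ true → IH.touches w f ≡ true → f ≡ pathEdge i ⊎ f ≡ pathEdge i'
      only f _ w∈f with edge-cases f
      ... | inj₁ (e , refl) with IH.touches⇒endpoint w∈f
      ...   | inj₁ p = ⊥-elim (inner-new inner-w (trans p (cong proj₁ (ψ-ends e))))
      ...   | inj₂ p = ⊥-elim (inner-new inner-w (trans p (cong proj₂ (ψ-ends e))))
      only f _ w∈f | inj₂ (j , refl) with IH.touches-EdgeJoins (pathEdge-joins j) w∈f
      ...   | inj₁ p = inj₂ (cong pathEdge (toℕ-injective (trans (sym (toℕ-inject₁ j)) (trans (cong toℕ (sym (path-inj p))) (sym i'≡1+i)))))
      ...   | inj₂ p = inj₁ (cong pathEdge (toℕ-injective (suc-injective (cong toℕ (path-inj (sym p))))))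

  lift : CycleIn G → CycleIn H
  lift c = record { len = len c ; len≥3 = len≥3 c ; vtx = φ ∘ vtx c ; vtx-inj = λ p → vtx-inj c (φ-inj p)
                  ; consec = λ i j i→j → Adjacent-φ (consec c i j i→j) }

  lift-edges : ∀ c T → HasEdges G c T → HasEdges H (lift c) (push T)
  lift-edges c T T-edges f = mk⇔ to from
    where
    to : f FS.∈ push T → CycleEdge H (lift c) f
    to f∈ with edge-cases f
    ... | inj₂ (i , refl) with () ← trans (sym ([]=⇒lookup f∈)) (push-PathFree T i)
    ... | inj₁ (e , refl) with Equivalence.to (T-edges e) (lookup⇒[]= e T (trans (sym (lookup-push-ψ T e)) ([]=⇒lookup f∈)))
    ...   | i , j , i→j , joins = i , j , i→j , ψ-joins joins
    from : CycleEdge H (lift c) f → f FS.∈ push T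
    from (i , j , i→j , joins) with EdgeJoins-φ⁻¹ joins
    ... | e , refl , joins' = lookup⇒[]= (ψ e) (push T) (trans (lookup-push-ψ T e) ([]=⇒lookup (Equivalence.from (T-edges e) (i , j , i→j , joins'))))

  lift-chordless : ∀ c → Chordless G c → Chordless H (lift c)
  lift-chordless c chordless i j adj = chordless i j (Adjacent-φ⁻¹ adj)

  module Lower (c : CycleIn H) (onG : ∀ i → ∃[ x ] vtx c i ≡ φ x) where
    private
      v : Fin (len c) → Fin (n G)
      v i = proj₁ (onG i)
      v≡ : ∀ i → vtx c i ≡ φ (v i)
      v≡ i = proj₂ (onG i)

    lower : CycleIn G
    lower = record { len = len c ; len≥3 = len≥3 c ; vtx = v
                   ; vtx-inj = λ {i} {j} p → vtx-inj c (trans (v≡ i) (trans (cong φ p) (sym (v≡ j))))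
                   ; consec = λ i j i→j → Adjacent-φ⁻¹ (subst₂ (Adjacent H) (v≡ i) (v≡ j) (consec c i j i→j)) }

    lower-edges : ∀ S → HasEdges H c S → HasEdges G lower (pull S)
    lower-edges S S-edges e = mk⇔ to from
      where
      to : e FS.∈ pull S → CycleEdge G lower e
      to e∈ with Equivalence.to (S-edges (ψ e)) (lookup⇒[]= (ψ e) S (trans (sym (lookup-pull S e)) ([]=⇒lookup e∈)))
      ... | i , j , i→j , joins with EdgeJoins-φ⁻¹ (subst₂ (EdgeJoins H (ψ e)) (v≡ i) (v≡ j) joins)
      ...   | e' , p , joins' = i , j , i→j , subst (λ e → EdgeJoins G e (v i) (v j)) (sym (ψ-inj p)) joins'
      from : CycleEdge G lower e → e FS.∈ pull S
      from (i , j , i→j , joins) = lookup⇒[]= e (pull S) (trans (lookup-pull S e) ([]=⇒lookup (Equivalence.from (S-edges (ψ e))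
             (i , j , i→j , subst₂ (EdgeJoins H (ψ e)) (sym (v≡ i)) (sym (v≡ j)) (ψ-joins joins)))))

    lower-chordless : Chordless H c → Chordless G lower
    lower-chordless chordless i j adj = chordless i j (subst₂ (Adjacent H) (sym (v≡ i)) (sym (v≡ j)) (Adjacent-φ adj))

  -- The new face: the path together with ψ e₀, i.e. every edge outside the image of ψ and ψ e₀.

  face : Subset (m H)
  face = tabulate (λ f → not (inImage ψ f) ∨ does (f ≟ ψ e₀))

  face-pathEdge : ∀ i → lookup face (pathEdge i) ≡ true
  face-pathEdge i rewrite lookup∘tabulate (λ f → not (inImage ψ f) ∨ does (f ≟ ψ e₀)) (pathEdge i)
                        | dec-false (any? λ e → ψ e ≟ pathEdge i) (λ (e , p) → ψ≢pathEdge e i p) = refl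

  face-ψ : ∀ e → lookup face (ψ e) ≡ does (e ≟ e₀)
  face-ψ e rewrite lookup∘tabulate (λ f → not (inImage ψ f) ∨ does (f ≟ ψ e₀)) (ψ e) | inImage-image ψ e =
    does-⇔ (mk⇔ ψ-inj (cong ψ)) (ψ e ≟ ψ e₀) (e ≟ e₀)

  pull-face : pull face ≡ ⁅ e₀ ⁆
  pull-face = lookup-ext λ e → trans (lookup-pull face e) (trans (face-ψ e) (sym (lookup-⁅⁆ e₀ e)))

  ∣face∣ : ∣ face ∣ ≡ suc L
  ∣face∣ = begin
    ∣ face ∣          ≡⟨ ∣∣-PathFull face face-pathEdge ⟩
    ∣ pull face ∣ + L ≡⟨ cong (λ S → ∣ S ∣ + L) pull-face ⟩
    ∣ ⁅ e₀ ⁆ ∣ + L    ≡⟨ cong (_+ L) (∣⁅x⁆∣≡1 e₀) ⟩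
    suc L             ∎
    where open ≡-Reasoning

  closing-joins : EdgeJoins H (ψ e₀) (path (fromℕ L)) (path zero)
  closing-joins = subst₂ (EdgeJoins H (ψ e₀)) (sym path-end) (sym path-start) (inj₂ (ψ-ends e₀))

  private
    ≡last : ∀ (i : Fin (suc L)) → toℕ i ≡ L → i ≡ fromℕ L
    ≡last i p = toℕ-injective (trans p (sym (toℕ-fromℕ L)))

  faceCycle : CycleIn H
  faceCycle = record { len = suc L ; len≥3 = s≤s L≥2 ; vtx = path ; vtx-inj = path-inj ; consec = consec' }
    where
    consec' : ∀ i j → CycNext i j → Adjacent H (path i) (path j)
    consec' i j (inj₁ j≡1+i) = path-adj i j j≡1+i
    consec' i j (inj₂ (i≡L , j≡0)) rewrite ≡last i i≡L | toℕ-injective {i = j} {j = zero} j≡0 = ψ e₀ , closing-joins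

  face-edges : HasEdges H faceCycle face
  face-edges f = mk⇔ to from
    where
    to : f FS.∈ face → CycleEdge H faceCycle f
    to f∈ with edge-cases f
    ... | inj₂ (i , refl) = inject₁ i , suc i , inj₁ (cong suc (sym (toℕ-inject₁ i))) , pathEdge-joins i
    ... | inj₁ (e , refl) with e ≟ e₀ | trans (sym (face-ψ e)) ([]=⇒lookup f∈)
    ...   | yes refl | _ = fromℕ L , zero , inj₂ (toℕ-fromℕ L , refl) , closing-joins
    ...   | no _ | ()
    from : CycleEdge H faceCycle f → f FS.∈ face
    from (i , j , inj₂ (i≡L , j≡0) , joins) rewrite ≡last i i≡L | toℕ-injective {i = j} {j = zero} j≡0 =
      lookup⇒[]= f face (subst (λ f → lookup face f ≡ true) (simple H (ψ e₀) f _ _ closing-joins joins)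
                                (trans (face-ψ e₀) (dec-true (e₀ ≟ e₀) refl)))
    from (i , j , inj₁ j≡1+i , joins) with edge-cases f
    ... | inj₂ (l , refl) = lookup⇒[]= _ face (face-pathEdge l)
    ... | inj₁ (e , refl) with ψ-endpoints e joins
    ...   | (_ , pi≡) , (_ , pj≡) with path-endpoint i pi≡ | path-endpoint j pj≡
    ...     | inj₁ i≡0 | inj₁ j≡0 = ⊥-elim (0≢1+n (trans (sym j≡0) (trans j≡1+i (cong suc i≡0))))
    ...     | inj₁ i≡0 | inj₂ j≡L = ⊥-elim (<-irrefl refl (subst (1 <_) (trans (sym j≡L) (trans j≡1+i (cong suc i≡0))) L≥2))
    ...     | inj₂ i≡L | inj₁ j≡0 = ⊥-elim (0≢1+n (trans (sym j≡0) j≡1+i))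
    ...     | inj₂ i≡L | inj₂ j≡L = ⊥-elim (1+n≢n (trans (sym (trans j≡1+i (cong suc i≡L))) j≡L))

  face-chordless : Chordless H faceCycle
  face-chordless i j (f , joins) with edge-cases f
  ... | inj₂ (l , refl) with Joins-unique (pathEdge-joins l) joins
  ...   | inj₁ (l≡i , 1+l≡j) = inj₁ (inj₁ (trans (cong toℕ (path-inj (sym 1+l≡j))) (cong suc (trans (sym (toℕ-inject₁ l)) (cong toℕ (path-inj l≡i))))))
  ...   | inj₂ (l≡j , 1+l≡i) = inj₂ (inj₁ (trans (cong toℕ (path-inj (sym 1+l≡i))) (cong suc (trans (sym (toℕ-inject₁ l)) (cong toℕ (path-inj l≡j))))))
  face-chordless i j (f , joins) | inj₁ (e , refl) with ψ-endpoints e joins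
  ... | (_ , pi≡) , (_ , pj≡) with path-endpoint i pi≡ | path-endpoint j pj≡
  ...   | inj₁ i≡0 | inj₁ j≡0 = ⊥-elim (EdgeJoins⇒≢ H joins (cong path (toℕ-injective (trans i≡0 (sym j≡0)))))
  ...   | inj₂ i≡L | inj₂ j≡L = ⊥-elim (EdgeJoins⇒≢ H joins (cong path (toℕ-injective (trans i≡L (sym j≡L)))))
  ...   | inj₁ i≡0 | inj₂ j≡L = inj₂ (inj₂ (j≡L , i≡0))
  ...   | inj₂ i≡L | inj₁ j≡0 = inj₁ (inj₂ (i≡L , j≡0))

  face-induced : IsInducedCycle H face
  face-induced = faceCycle , face-edges , face-chordless

-- The inductive step

K≤K*u : ∀ K u → 1 ≤ u → K ≤ K * u
K≤K*u K u 1≤u = subst (_≤ K * u) (*-identityʳ K) (*-monoʳ-≤ K 1≤u)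

-- In the step, W, ν, u, s are the weight, number of nonempty members, number of members using the new path
-- and total slack of a generating family of H; primes refer to its projection to G and f to the faces of G.
excess-bound : ∀ W W' Wf ν ν' ℓ k s → W + 3 * ν' ≡ W' + 3 * ν + k + s → Wf + 3 * ν' ≤ W' + 3 * ℓ →
               Wf + 3 * ν + k + s ≤ W + 3 * ℓ
excess-bound W W' Wf ν ν' ℓ k s balance induction = +-cancelʳ-≤ (3 * ν') _ _ (begin
  (Wf + 3 * ν + k + s) + 3 * ν'  ≡⟨ shuffle₁ Wf ν k s ν' ⟩
  (Wf + 3 * ν') + (3 * ν + k + s) ≤⟨ +-monoˡ-≤ (3 * ν + k + s) induction ⟩
  (W' + 3 * ℓ) + (3 * ν + k + s)  ≡⟨ shuffle₂ W' ℓ ν k s ⟩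
  (W' + 3 * ν + k + s) + 3 * ℓ    ≡⟨ cong (_+ 3 * ℓ) (sym balance) ⟩
  (W + 3 * ν') + 3 * ℓ           ≡⟨ shuffle₃ W ν' ℓ ⟩
  (W + 3 * ℓ) + 3 * ν'           ∎)
  where
  open ≤-Reasoning
  shuffle₁ : ∀ Wf ν k s ν' → (Wf + 3 * ν + k + s) + 3 * ν' ≡ (Wf + 3 * ν') + (3 * ν + k + s)
  shuffle₁ = solve-∀
  shuffle₂ : ∀ W' ℓ ν k s → (W' + 3 * ℓ) + (3 * ν + k + s) ≡ (W' + 3 * ν + k + s) + 3 * ℓ
  shuffle₂ = solve-∀
  shuffle₃ : ∀ W ν' ℓ → (W + 3 * ν') + 3 * ℓ ≡ (W + 3 * ℓ) + 3 * ν'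
  shuffle₃ = solve-∀

weight-step : ∀ W W' Wf ν ν' ℓ K u s → W + 3 * ν' ≡ W' + 3 * ν + K * u + s → Wf + 3 * ν' ≤ W' + 3 * ℓ → 1 ≤ u →
              (3 + K + Wf) + 3 * ν ≤ W + 3 * suc ℓ
weight-step W W' Wf ν ν' ℓ K u s balance induction 1≤u = begin
  (3 + K + Wf) + 3 * ν        ≡⟨ shuffle K Wf ν ⟩
  (Wf + 3 * ν + K + 0) + 3    ≤⟨ +-monoˡ-≤ 3 (+-mono-≤ (+-monoʳ-≤ (Wf + 3 * ν) (K≤K*u K u 1≤u)) z≤n) ⟩
  (Wf + 3 * ν + K * u + s) + 3 ≤⟨ +-monoˡ-≤ 3 (excess-bound W W' Wf ν ν' ℓ (K * u) s balance induction) ⟩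
  (W + 3 * ℓ) + 3             ≡⟨ +-assoc W (3 * ℓ) 3 ⟩
  W + (3 * ℓ + 3)             ≡⟨ cong (W +_) (trans (+-comm (3 * ℓ) 3) (sym (*-suc 3 ℓ))) ⟩
  W + 3 * suc ℓ               ∎
  where
  open ≤-Reasoning
  shuffle : ∀ K Wf ν → (3 + K + Wf) + 3 * ν ≡ (Wf + 3 * ν + K + 0) + 3
  shuffle = solve-∀

slack-vanishes : ∀ W W' Wf ν ν' ℓ K u s → W + 3 * ν' ≡ W' + 3 * ν + K * u + s → Wf + 3 * ν' ≤ W' + 3 * ℓ → 1 ≤ u →
                 suc ℓ ≤ ν → W ≤ 3 + K + Wf → s ≡ 0
slack-vanishes W W' Wf ν ν' ℓ K u s balance induction 1≤u ℓ<ν W≤ = n≤0⇒n≡0 (+-cancelˡ-≤ (Wf + 3 * suc ℓ + K) s 0 (begin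
  (Wf + 3 * suc ℓ + K) + s    ≤⟨ +-monoˡ-≤ s (+-mono-≤ (+-monoʳ-≤ Wf (*-monoʳ-≤ 3 ℓ<ν)) (K≤K*u K u 1≤u)) ⟩
  Wf + 3 * ν + K * u + s      ≤⟨ excess-bound W W' Wf ν ν' ℓ (K * u) s balance induction ⟩
  W + 3 * ℓ                   ≤⟨ +-monoˡ-≤ (3 * ℓ) W≤ ⟩
  3 + K + Wf + 3 * ℓ          ≡⟨ shuffle K Wf ℓ ⟩
  (Wf + 3 * suc ℓ + K) + 0    ∎))
  where
  open ≤-Reasoning
  shuffle : ∀ K Wf ℓ → 3 + K + Wf + 3 * ℓ ≡ (Wf + 3 * suc ℓ + K) + 0
  shuffle = solve-∀

tight-projection : ∀ W W' Wf ν ν' ℓ K u → W + 3 * ν' ≡ W' + 3 * ν + K * u + 0 → ν' + u ≡ ν → 1 ≤ u →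
                   ν ≤ suc ℓ → W ≤ 3 + K + Wf → ν' ≤ ℓ × W' ≤ Wf
tight-projection W W' Wf ν ν' ℓ K u balance ν'+u≡ν 1≤u ν≤ W≤ = ν'≤ℓ , W'≤Wf
  where
  open ≤-Reasoning
  ν'≤ℓ : ν' ≤ ℓ
  ν'≤ℓ = +-cancelʳ-≤ 1 ν' ℓ (begin
    ν' + 1  ≤⟨ +-monoʳ-≤ ν' 1≤u ⟩
    ν' + u  ≡⟨ ν'+u≡ν ⟩
    ν       ≤⟨ ν≤ ⟩
    suc ℓ   ≡⟨ +-comm 1 ℓ ⟩
    ℓ + 1   ∎)
  W≡ : W ≡ W' + (3 + K) * u
  W≡ = +-cancelʳ-≡ (3 * ν') W (W' + (3 + K) * u) (begin-equality
    W + 3 * ν'                     ≡⟨ balance ⟩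
    W' + 3 * ν + K * u + 0         ≡⟨ cong (λ x → W' + 3 * x + K * u + 0) (sym ν'+u≡ν) ⟩
    W' + 3 * (ν' + u) + K * u + 0  ≡⟨ shuffle W' ν' u K ⟩
    W' + (3 + K) * u + 3 * ν'      ∎)
    where
    shuffle : ∀ W' ν' u K → W' + 3 * (ν' + u) + K * u + 0 ≡ W' + (3 + K) * u + 3 * ν'
    shuffle = solve-∀
  W'≤Wf : W' ≤ Wf
  W'≤Wf = +-cancelʳ-≤ (3 + K) W' Wf (begin
    W' + (3 + K)        ≤⟨ +-monoʳ-≤ W' (subst (_≤ (3 + K) * u) (*-identityʳ (3 + K)) (*-monoʳ-≤ (3 + K) 1≤u)) ⟩
    W' + (3 + K) * u    ≡⟨ sym W≡ ⟩
    W                   ≤⟨ W≤ ⟩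
    3 + K + Wf          ≡⟨ +-comm (3 + K) Wf ⟩
    Wf + (3 + K)        ∎)

toggle : ∀ {k} → Bool → Subset k → Subset k
toggle true X = X
toggle false X = FS.⊥

toggle-xor : ∀ {k} x y (X : Subset k) → toggle (x xor y) X ≡ toggle x X ⊕ toggle y X
toggle-xor true true X = sym (⊕-self X)
toggle-xor true false X = sym (⊕-identityʳ X)
toggle-xor false y X = sym (⊕-identityˡ (toggle y X))

module Step {G H : Graph} (ext : PathExtension G H) (FB : FaceBasis G) where
  open PathExtension ext
  open Extension ext
  open FaceBasis FB

  first-index : Fin L
  first-index = fromℕ< (≤-trans (s≤s z≤n) L≥2)

  first : Fin (m H)
  first = pathEdge first-index

  Eulerian-path : ∀ {b} → Eulerian H b → ∀ i → lookup b (pathEdge i) ≡ lookup b first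
  Eulerian-path {b} b-even i = Eulerian-path-constant b b-even i first-index

  ∉first⇒PathFree : ∀ {b} → Eulerian H b → lookup b first ≡ false → PathFree b
  ∉first⇒PathFree {b} b-even ∉b i = trans (Eulerian-path {b} b-even i) ∉b

  -- If b uses the new path, adding X (which contains the whole path) removes it.
  clear : Subset (m H) → Subset (m H) → Subset (m H)
  clear X b = b ⊕ toggle (lookup b first) X

  project : Subset (m H) → Subset (m H) → Subset (m G)
  project X b = pull (clear X b)

  clear-∉first : ∀ X {b} → lookup b first ≡ false → clear X b ≡ b
  clear-∉first X {b} ∉b = trans (cong (λ t → b ⊕ toggle t X) ∉b) (⊕-identityʳ b)

  clear-∈first : ∀ X {b} → lookup b first ≡ true → clear X b ≡ b ⊕ X
  clear-∈first X {b} ∈b = cong (λ t → b ⊕ toggle t X) ∈b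

  project-hom : ∀ X → ⊕-Homomorphism (project X)
  project-hom X = project-⊥ , project-⊕
    where
    project-⊥ : project X FS.⊥ ≡ FS.⊥
    project-⊥ = trans (cong pull (clear-∉first X {FS.⊥} (lookup-⊥ first))) pull-⊥
    project-⊕ : ∀ a b → project X (a ⊕ b) ≡ project X a ⊕ project X b
    project-⊕ a b = trans (cong pull (begin
      (a ⊕ b) ⊕ toggle (lookup (a ⊕ b) first) X                        ≡⟨ cong (λ t → (a ⊕ b) ⊕ toggle t X) (lookup-⊕ a b first) ⟩
      (a ⊕ b) ⊕ toggle (lookup a first xor lookup b first) X            ≡⟨ cong ((a ⊕ b) ⊕_) (toggle-xor (lookup a first) (lookup b first) X) ⟩
      (a ⊕ b) ⊕ (toggle (lookup a first) X ⊕ toggle (lookup b first) X) ≡⟨ ⊕-interchange a b (toggle (lookup a first) X) (toggle (lookup b first) X) ⟩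
      clear X a ⊕ clear X b                                             ∎)) (pull-⊕ (clear X a) (clear X b))
      where open ≡-Reasoning

  project-push : ∀ X T → project X (push T) ≡ T
  project-push X T = trans (cong pull (clear-∉first X {push T} (push-PathFree T first-index))) (pull-push T)

  project-generates : ∀ X {B} → Generates H B → Generates G (map (project X) B)
  project-generates X {B} B-gen C (c , C-edges) with B-gen (push C) (lift c , lift-edges c C C-edges)
  ... | S , S⊆B , pushC≡ΣS = map (project X) S , ⊆-map⁺ (project X) S⊆B ,
        sym (trans (⊕-sum-map (project-hom X) S) (trans (cong (project X) (sym pushC≡ΣS)) (project-push X C)))

  module _ (X : Subset (m H)) (X-even : Eulerian H X) (X-full : ∀ i → lookup X (pathEdge i) ≡ true) where

    clear-PathFree : ∀ {b} → Eulerian H b → PathFree (clear X b)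
    clear-PathFree {b} b-even i with lookup b first in b₁
    ... | true = trans (lookup-⊕ b X (pathEdge i)) (cong₂ _xor_ (trans (Eulerian-path {b} b-even i) b₁) (X-full i))
    ... | false = trans (lookup-⊕ b FS.⊥ (pathEdge i)) (cong₂ _xor_ (trans (Eulerian-path {b} b-even i) b₁) (lookup-⊥ (pathEdge i)))

    clear-Eulerian : ∀ {b} → Eulerian H b → Eulerian H (clear X b)
    clear-Eulerian {b} b-even = Incidence.Eulerian-⊕ H {b} b-even (toggle-Eulerian (lookup b first))
      where
      toggle-Eulerian : ∀ t → Eulerian H (toggle t X)
      toggle-Eulerian true = X-even
      toggle-Eulerian false = Incidence.Eulerian-⊥ H

    project-Eulerian : ∀ {b} → Eulerian H b → Eulerian G (project X b)
    project-Eulerian {b} b-even = Eulerian-pull (clear X b) (clear-PathFree {b} b-even) (clear-Eulerian {b} b-even)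

    project-EulerianGenerating : ∀ {B} → EulerianGenerating H B → EulerianGenerating G (map (project X) B)
    project-EulerianGenerating (B-even , B-gen) = All-map⁺ (All.map (λ {b} → project-Eulerian {b}) B-even) , project-generates X B-gen

  facesH : List (Subset (m H))
  facesH = face ∷ map push faces

  face-Eulerian : Eulerian H face
  face-Eulerian = IsCycle⇒Eulerian (faceCycle , face-edges)

  face≢push : ∀ T → face ≢ push T
  face≢push T p with () ← trans (sym (face-pathEdge first-index)) (trans (cong (λ S → lookup S first) p) (push-PathFree T first-index))

  facesH-unique : Unique facesH
  facesH-unique = All.tabulate (λ S∈ face≡S → let (T , _ , S≡pushT) = ∈-map⁻ push S∈ in face≢push T (trans face≡S S≡pushT))
                ∷ Unique.map⁺ push-injective faces-unique

  private
    1≤L : 1 ≤ L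
    1≤L = ≤-trans (s≤s z≤n) L≥2

    last-index : Fin L
    last-index = fromℕ< (∸-monoʳ-< {L} {1} {0} (s≤s z≤n) 1≤L)

    inject₁-first : inject₁ first-index ≡ zero
    inject₁-first = toℕ-injective (trans (toℕ-inject₁ first-index) (toℕ-fromℕ< _))

    suc-last : suc last-index ≡ fromℕ L
    suc-last = toℕ-injective (trans (cong suc (toℕ-fromℕ< _)) (trans (+-comm 1 (L ∸ 1)) (trans (m∸n+n≡m 1≤L) (sym (toℕ-fromℕ L)))))

  -- An induced cycle through the path also contains e₀ (a chord otherwise), hence the whole face.
  module ThroughPath {S} (c : CycleIn H) (S-edges : HasEdges H c S) (chordless : Chordless H c)
                     (∋first : lookup S first ≡ true) where
    open OnCycle H c

    path⊆S : ∀ i → lookup S (pathEdge i) ≡ true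
    path⊆S i = trans (Eulerian-path {S} (IsCycle⇒Eulerian (c , S-edges)) i) ∋first

    endpoint-on-c : ∀ {f a b} → lookup S f ≡ true → EdgeJoins H f a b → ∃[ p ] vtx c p ≡ a
    endpoint-on-c f∈S joins with ∈S⇒edge S S-edges f∈S
    ... | j , refl with Joins-unique (edge-joins j) joins
    ...   | inj₁ (vj≡a , _) = j , vj≡a
    ...   | inj₂ (_ , vnj≡a) = next j , vnj≡a

    start-on-c : ∃[ p ] vtx c p ≡ path zero
    start-on-c = let (p , q) = endpoint-on-c (path⊆S first-index) (pathEdge-joins first-index) in p , trans q (cong path inject₁-first)

    end-on-c : ∃[ p ] vtx c p ≡ path (fromℕ L)
    end-on-c = let (p , q) = endpoint-on-c (path⊆S last-index) (Joins-sym (pathEdge-joins last-index)) in p , trans q (cong path suc-last)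

    e₀∈S : lookup S (ψ e₀) ≡ true
    e₀∈S = []=⇒lookup (Equivalence.from (S-edges (ψ e₀)) (consecutive-edge (chordless q p (ψ e₀ , joins))))
      where
      p = proj₁ start-on-c
      q = proj₁ end-on-c
      joins : EdgeJoins H (ψ e₀) (vtx c q) (vtx c p)
      joins = subst₂ (EdgeJoins H (ψ e₀)) (sym (proj₂ end-on-c)) (sym (proj₂ start-on-c)) closing-joins
      consecutive-edge : CycNext q p ⊎ CycNext p q → CycleEdge H c (ψ e₀)
      consecutive-edge (inj₁ q→p) = q , p , q→p , joins
      consecutive-edge (inj₂ p→q) = p , q , p→q , Joins-sym joins

    face⊆S : face FS.⊆ S
    face⊆S {f} f∈face with edge-cases f
    ... | inj₂ (i , refl) = lookup⇒[]= _ S (path⊆S i)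
    ... | inj₁ (e , refl) with e ≟ e₀ | trans (sym (face-ψ e)) ([]=⇒lookup f∈face)
    ...   | yes refl | _ = lookup⇒[]= _ S e₀∈S
    ...   | no _ | ()

    ≡face : S ≡ face
    ≡face with Eulerian-⊆-cycle S S-edges face face-Eulerian face⊆S
    ... | inj₂ face≡S = sym face≡S
    ... | inj₁ face≡⊥ with () ← trans (sym (face-pathEdge first-index)) (trans (cong (λ T → lookup T first) face≡⊥) (lookup-⊥ first))

  PathFree-induced⇒pull-induced : ∀ {S} → IsInducedCycle H S → PathFree S → IsInducedCycle G (pull S)
  PathFree-induced⇒pull-induced {S} (c , S-edges , chordless) S-free = lower , lower-edges S S-edges , lower-chordless chordless
    where
    open OnCycle H c
    on-G : ∀ i → ∃[ x ] vtx c i ≡ φ x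
    on-G i with edge-cases (edge i)
    ... | inj₂ (j , p) with () ← trans (sym (edge∈S S S-edges i)) (trans (cong (lookup S) p) (S-free j))
    ... | inj₁ (e , p) = proj₁ (ψ-endpoints e (subst (λ f → EdgeJoins H f _ _) p (edge-joins i)))
    open Lower c on-G

  ∈facesH⇔induced : ∀ S → (S ∈ facesH) ⇔ IsInducedCycle H S
  ∈facesH⇔induced S = mk⇔ to from
    where
    to : S ∈ facesH → IsInducedCycle H S
    to (here refl) = face-induced
    to (there S∈) with ∈-map⁻ push S∈
    ... | F , F∈ , refl with Equivalence.to (∈faces⇔induced F) F∈
    ...   | c , F-edges , chordless = lift c , lift-edges c F F-edges , lift-chordless c chordless
    from : IsInducedCycle H S → S ∈ facesH
    from S-induced@(c , S-edges , chordless) with lookup S first in S₁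
    ... | true = here (ThroughPath.≡face c S-edges chordless S₁)
    ... | false = there (subst (_∈ map push faces) (push-pull S S-free)
                    (∈-map⁺ push (Equivalence.from (∈faces⇔induced (pull S)) (PathFree-induced⇒pull-induced S-induced S-free))))
      where S-free = ∉first⇒PathFree {S} (IsCycle⇒Eulerian (c , S-edges)) S₁

  cleared-span : ∀ {C} → Eulerian H C → Span (_∈ facesH) (clear face C)
  cleared-span {C} C-even = subst (Span _) (push-pull (clear face C) (clear-PathFree face face-Eulerian face-pathEdge {C} C-even))
    (Span-hom (push-⊥ , push-⊕) (λ F∈ → there (∈-map⁺ push F∈))
      (faces-span (project face C) (project-Eulerian face face-Eulerian face-pathEdge {C} C-even)))

  facesH-span : ∀ C → Eulerian H C → Span (_∈ facesH) C
  facesH-span C C-even with lookup C first in C₁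
  ... | false = subst (Span _) (clear-∉first face {C} C₁) (cleared-span {C} C-even)
  ... | true = subst (Span _) face⊕cleared (here refl ∷ cleared-span {C} C-even)
    where
    face⊕cleared : face ⊕ clear face C ≡ C
    face⊕cleared = trans (cong (face ⊕_) (clear-∈first face {C} C₁)) (trans (⊕-comm face (C ⊕ face)) (⊕-cancelʳ C face))

  ∃member∋first : ∀ {B} → Generates H B → ∃[ b ] (b ∈ B × lookup b first ≡ true)
  ∃member∋first B-gen with B-gen face (faceCycle , face-edges)
  ... | S , S⊆B , face≡ΣS with ∈⊕-sum⇒∈member S first (trans (cong (λ T → lookup T first) (sym face≡ΣS)) (face-pathEdge first-index))
  ...   | b , b∈S , ∋first = b , Any-resp-⊆ S⊆B b∈S , ∋first

  module _ (X : Subset (m H)) where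

    nonempty-project≤ : ∀ {b} → Eulerian H b → 1 ⊓ ∣ project X b ∣ ≤ 1 ⊓ ∣ b ∣
    nonempty-project≤ {b} b-even = by-first (lookup b first) refl
      where
      by-first : ∀ t → lookup b first ≡ t → 1 ⊓ ∣ project X b ∣ ≤ 1 ⊓ ∣ b ∣
      by-first false b₁ = ≤-reflexive (trans (cong (λ T → 1 ⊓ ∣ pull T ∣) (clear-∉first X {b} b₁))
                                              (cong (1 ⊓_) (sym (∣∣-PathFree b (∉first⇒PathFree {b} b-even b₁)))))
      by-first true b₁ = subst (1 ⊓ ∣ project X b ∣ ≤_) (sym (m≤n⇒m⊓n≡m (∈⇒0<∣∣ b b₁))) (m⊓n≤m 1 _)

    #nonempty-project≤ : ∀ {B} → All (Eulerian H) B → #nonempty (map (project X) B) ≤ #nonempty B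
    #nonempty-project≤ [] = z≤n
    #nonempty-project≤ {b ∷ _} (b-even ∷ B-even) = +-mono-≤ (nonempty-project≤ {b} b-even) (#nonempty-project≤ B-even)

    #nonempty-project< : ∀ {B x} → All (Eulerian H) B → x ∈ B → 1 ⊓ ∣ project X x ∣ < 1 ⊓ ∣ x ∣ →
                         #nonempty (map (project X) B) < #nonempty B
    #nonempty-project< (b-even ∷ B-even) (here refl) lt = +-mono-<-≤ lt (#nonempty-project≤ B-even)
    #nonempty-project< {b ∷ _} (b-even ∷ B-even) (there x∈) lt = +-mono-≤-< (nonempty-project≤ {b} b-even) (#nonempty-project< B-even x∈ lt)

  facesH≤#nonempty : ∀ B → EulerianGenerating H B → length facesH ≤ #nonempty B
  facesH≤#nonempty B (B-even , B-gen) with ∃member∋first B-gen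
  ... | b , b∈B , ∋first = begin
    length facesH                        ≡⟨ cong suc (length-map push faces) ⟩
    suc (length faces)                   ≤⟨ s≤s (faces≤#nonempty _ (project-EulerianGenerating b b-even b-full (B-even , B-gen))) ⟩
    suc (#nonempty (map (project b) B))  ≤⟨ #nonempty-project< b B-even b∈B b-vanishes ⟩
    #nonempty B                          ∎
    where
    open ≤-Reasoning
    b-even = All.lookup B-even b∈B
    b-full : ∀ i → lookup b (pathEdge i) ≡ true
    b-full i = trans (Eulerian-path {b} b-even i) ∋first
    b-vanishes : 1 ⊓ ∣ project b b ∣ < 1 ⊓ ∣ b ∣
    b-vanishes rewrite clear-∈first b {b} ∋first | ⊕-self b | pull-⊥ | ∣⊥∣≡0 (m G) | m≤n⇒m⊓n≡m (∈⇒0<∣∣ b ∋first) = s≤s z≤n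


  K : ℕ
  K = L ∸ 2

  L≡2+K : L ≡ 2 + K
  L≡2+K = trans (sym (m∸n+n≡m L≥2)) (+-comm K 2)

  uses : Subset (m H) → ℕ
  uses b = bit (lookup b first)

  -- How weight and nonemptiness change when b is projected along the new face; zero slack characterises the face.
  record Excess (b : Subset (m H)) : Set where
    field
      slack : ℕ
      balance : ∣ b ∣ + 3 * (1 ⊓ ∣ project face b ∣) ≡ ∣ project face b ∣ + 3 * (1 ⊓ ∣ b ∣) + K * uses b + slack
      no-slack⇒face : slack ≡ 0 → lookup b first ≡ true → b ≡ face

  ∣project∣-∉first : ∀ {b} → Eulerian H b → lookup b first ≡ false → ∣ project face b ∣ ≡ ∣ b ∣
  ∣project∣-∉first {b} b-even ∉b =
    trans (cong (λ S → ∣ pull S ∣) (clear-∉first face {b} ∉b)) (sym (∣∣-PathFree b (∉first⇒PathFree {b} b-even ∉b)))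

  excess-∉first : ∀ {b} → Eulerian H b → lookup b first ≡ false → Excess b
  excess-∉first {b} b-even ∉b = record { slack = 0 ; balance = balance ; no-slack⇒face = λ _ ∈b → ⊥-elim (false≢true (trans (sym ∉b) ∈b)) }
    where
    false≢true : false ≢ true
    false≢true ()
    balance : ∣ b ∣ + 3 * (1 ⊓ ∣ project face b ∣) ≡ ∣ project face b ∣ + 3 * (1 ⊓ ∣ b ∣) + K * uses b + 0
    balance rewrite ∣project∣-∉first {b} b-even ∉b | ∉b = arith ∣ b ∣ (1 ⊓ ∣ b ∣) K
      where
      arith : ∀ x y K → x + 3 * y ≡ x + 3 * y + K * 0 + 0
      arith = solve-∀

  module UsingPath {b} (b-even : Eulerian H b) (∈b : lookup b first ≡ true) where
    ∣b∣≡ : ∣ b ∣ ≡ ∣ pull b ∣ + L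
    ∣b∣≡ = ∣∣-PathFull b (λ i → trans (Eulerian-path {b} b-even i) ∈b)

    project≡ : project face b ≡ pull b ⊕ ⁅ e₀ ⁆
    project≡ = trans (cong pull (clear-∈first face {b} ∈b)) (trans (pull-⊕ b face) (cong (pull b ⊕_) pull-face))

    ∣project∣ : ∣ project face b ∣ + bit (lookup (pull b) e₀) ≡ ∣ pull b ∣ + bit (not (lookup (pull b) e₀))
    ∣project∣ = trans (cong (λ S → ∣ S ∣ + bit (lookup (pull b) e₀)) project≡) (∣⊕⁅⁆∣ (pull b) e₀)

    ν-b : 1 ⊓ ∣ b ∣ ≡ 1
    ν-b = m≤n⇒m⊓n≡m (∈⇒0<∣∣ b ∈b)

    uses-b : uses b ≡ 1
    uses-b = cong bit ∈b

    project≡⊥⇒face : project face b ≡ FS.⊥ → b ≡ face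
    project≡⊥⇒face project≡⊥ = begin
      b                    ≡⟨ sym (⊕-cancelʳ b face) ⟩
      (b ⊕ face) ⊕ face    ≡⟨ cong (_⊕ face) (sym (clear-∈first face {b} ∈b)) ⟩
      clear face b ⊕ face  ≡⟨ cong (_⊕ face) (sym (push-pull (clear face b) (clear-PathFree face face-Eulerian face-pathEdge {b} b-even))) ⟩
      push (project face b) ⊕ face ≡⟨ cong (λ S → push S ⊕ face) project≡⊥ ⟩
      push FS.⊥ ⊕ face     ≡⟨ cong (_⊕ face) push-⊥ ⟩
      FS.⊥ ⊕ face          ≡⟨ ⊕-identityˡ face ⟩
      face                 ∎
      where open ≡-Reasoning

    e₀∉-excess : lookup (pull b) e₀ ≡ false → Excess b
    e₀∉-excess e₀∉ = record { slack = 1 ; balance = balance ; no-slack⇒face = λ () }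
      where
      ∣project∣≡ : ∣ project face b ∣ ≡ suc ∣ pull b ∣
      ∣project∣≡ = trans (sym (+-identityʳ _)) (trans (subst (λ t → ∣ project face b ∣ + bit t ≡ ∣ pull b ∣ + bit (not t)) e₀∉ ∣project∣) (+-comm _ 1))
      balance : ∣ b ∣ + 3 * (1 ⊓ ∣ project face b ∣) ≡ ∣ project face b ∣ + 3 * (1 ⊓ ∣ b ∣) + K * uses b + 1
      balance rewrite ν-b | uses-b | ∣project∣≡ | ∣b∣≡ = trans (cong (λ l → ∣ pull b ∣ + l + 3 * 1) L≡2+K) (arith ∣ pull b ∣ K)
        where
        arith : ∀ p K → p + (2 + K) + 3 * 1 ≡ suc p + 3 * 1 + K * 1 + 1
        arith = solve-∀

    e₀∈-excess : lookup (pull b) e₀ ≡ true → Excess b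
    e₀∈-excess e₀∈ = by-size ∣ project face b ∣ refl
      where
      ∣pull∣≡ : ∣ pull b ∣ ≡ ∣ project face b ∣ + 1
      ∣pull∣≡ = trans (sym (+-identityʳ _)) (sym (subst (λ t → ∣ project face b ∣ + bit t ≡ ∣ pull b ∣ + bit (not t)) e₀∈ ∣project∣))
      by-size : ∀ s → ∣ project face b ∣ ≡ s → Excess b
      by-size zero ∣project∣≡0 = record
        { slack = 0 ; balance = balance ; no-slack⇒face = λ _ _ → project≡⊥⇒face (∣∣≡0⇒≡⊥ (project face b) ∣project∣≡0) }
        where
        balance : ∣ b ∣ + 3 * (1 ⊓ ∣ project face b ∣) ≡ ∣ project face b ∣ + 3 * (1 ⊓ ∣ b ∣) + K * uses b + 0
        balance rewrite ν-b | uses-b | ∣b∣≡ | ∣pull∣≡ | ∣project∣≡0 = trans (cong (λ l → 0 + 1 + l + 3 * 0) L≡2+K) (arith K)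
          where
          arith : ∀ K → 0 + 1 + (2 + K) + 3 * 0 ≡ 0 + 3 * 1 + K * 1 + 0
          arith = solve-∀
      by-size (suc t) ∣project∣≡ = record { slack = 3 ; balance = balance ; no-slack⇒face = λ () }
        where
        balance : ∣ b ∣ + 3 * (1 ⊓ ∣ project face b ∣) ≡ ∣ project face b ∣ + 3 * (1 ⊓ ∣ b ∣) + K * uses b + 3
        balance rewrite ν-b | uses-b | ∣b∣≡ | ∣pull∣≡ | ∣project∣≡ = trans (cong (λ l → suc t + 1 + l + 3 * 1) L≡2+K) (arith t K)
          where
          arith : ∀ t K → suc t + 1 + (2 + K) + 3 * 1 ≡ suc t + 3 * 1 + K * 1 + 3
          arith = solve-∀

    excess-∈first : Excess b
    excess-∈first with lookup (pull b) e₀ in e₀∈?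
    ... | true = e₀∈-excess e₀∈?
    ... | false = e₀∉-excess e₀∈?

  excess : ∀ {b} → Eulerian H b → Excess b
  excess {b} b-even = by-first (lookup b first) refl
    where
    by-first : ∀ t → lookup b first ≡ t → Excess b
    by-first true ∈b = UsingPath.excess-∈first b-even ∈b
    by-first false ∉b = excess-∉first b-even ∉b

  #uses : List (Subset (m H)) → ℕ
  #uses B = sum (map uses B)

  record Balance (B : List (Subset (m H))) : Set where
    field
      slack : ℕ
      balance : weight B + 3 * #nonempty (map (project face) B) ≡
                weight (map (project face) B) + 3 * #nonempty B + K * #uses B + slack
      no-slack⇒face : slack ≡ 0 → All (λ b → lookup b first ≡ true → b ≡ face) B

  balanced : ∀ {B} → All (Eulerian H) B → Balance B
  balanced [] = record { slack = 0 ; balance = cong (_+ 0) (sym (*-zeroʳ K)) ; no-slack⇒face = λ _ → [] }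
  balanced {b ∷ B} (b-even ∷ B-even) = record
    { slack = slack e + slack r
    ; balance = trans (regroup₁ ∣ b ∣ (weight B) (1 ⊓ ∣ project face b ∣) (#nonempty (map (project face) B)))
                (trans (cong₂ _+_ (Excess.balance e) (Balance.balance r))
                (regroup₂ ∣ project face b ∣ (weight (map (project face) B)) (1 ⊓ ∣ b ∣) (#nonempty B) K (uses b) (#uses B) (slack e) (slack r)))
    ; no-slack⇒face = λ s≡0 → Excess.no-slack⇒face e (m+n≡0⇒m≡0 (slack e) s≡0) ∷ Balance.no-slack⇒face r (m+n≡0⇒n≡0 (slack e) s≡0)
    }
    where
    e = excess {b} b-even
    r = balanced B-even
    open Excess using (slack)
    open Balance using (slack)
    regroup₁ : ∀ x W y Y → (x + W) + 3 * (y + Y) ≡ (x + 3 * y) + (W + 3 * Y)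
    regroup₁ = solve-∀
    regroup₂ : ∀ x W y Y K u U s S → (x + 3 * y + K * u + s) + (W + 3 * Y + K * U + S) ≡ (x + W) + 3 * (y + Y) + K * (u + U) + (s + S)
    regroup₂ = solve-∀

  project-face : project face face ≡ FS.⊥
  project-face = trans (cong pull (trans (clear-∈first face {face} (face-pathEdge first-index)) (⊕-self face))) pull-⊥

  #nonempty-project-face : ∀ {B} → All (Eulerian H) B → All (λ b → lookup b first ≡ true → b ≡ face) B →
                           #nonempty (map (project face) B) + #uses B ≡ #nonempty B
  #nonempty-project-face [] [] = refl
  #nonempty-project-face {b ∷ B} (b-even ∷ B-even) (b≡face ∷ B≡face) =
    trans (regroup (1 ⊓ ∣ project face b ∣) (#nonempty (map (project face) B)) (uses b) (#uses B))
          (cong₂ _+_ (by-first (lookup b first) refl) (#nonempty-project-face B-even B≡face))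
    where
    regroup : ∀ x X u U → (x + X) + (u + U) ≡ (x + u) + (X + U)
    regroup = solve-∀
    by-first : ∀ t → lookup b first ≡ t → 1 ⊓ ∣ project face b ∣ + uses b ≡ 1 ⊓ ∣ b ∣
    by-first false ∉b = trans (cong (λ t → 1 ⊓ ∣ project face b ∣ + bit t) ∉b)
                              (trans (+-identityʳ _) (cong (1 ⊓_) (∣project∣-∉first {b} b-even ∉b)))
    by-first true ∈b = begin
      1 ⊓ ∣ project face b ∣ + uses b          ≡⟨ cong (λ S → 1 ⊓ ∣ project face S ∣ + uses S) (b≡face ∈b) ⟩
      1 ⊓ ∣ project face face ∣ + uses face    ≡⟨ cong₂ (λ S t → 1 ⊓ ∣ S ∣ + bit t) project-face (face-pathEdge first-index) ⟩
      1 ⊓ ∣ FS.⊥ {m G} ∣ + 1                  ≡⟨ cong (λ x → 1 ⊓ x + 1) (∣⊥∣≡0 (m G)) ⟩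
      1                                        ≡⟨ sym (m≤n⇒m⊓n≡m (∈⇒0<∣∣ face (face-pathEdge first-index))) ⟩
      1 ⊓ ∣ face ∣                             ≡⟨ cong (λ S → 1 ⊓ ∣ S ∣) (sym (b≡face ∈b)) ⟩
      1 ⊓ ∣ b ∣                                ∎
      where open ≡-Reasoning

  1≤#uses : ∀ {B x} → x ∈ B → lookup x first ≡ true → 1 ≤ #uses B
  1≤#uses {x ∷ B} (here refl) ∈x rewrite ∈x = s≤s z≤n
  1≤#uses {b ∷ B} (there x∈) ∈x = ≤-trans (1≤#uses x∈ ∈x) (m≤n+m (#uses B) (uses b))

  weight-map-push : ∀ T → weight (map push T) ≡ weight T
  weight-map-push [] = refl
  weight-map-push (F ∷ T) = cong₂ _+_ (∣push∣ F) (weight-map-push T)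

  weight-facesH : weight facesH ≡ 3 + K + weight faces
  weight-facesH = cong₂ _+_ (trans ∣face∣ (cong suc L≡2+K)) (weight-map-push faces)

  length-facesH : length facesH ≡ suc (length faces)
  length-facesH = cong suc (length-map push faces)

  push-project-∉first : ∀ {b} → Eulerian H b → lookup b first ≡ false → push (project face b) ≡ b
  push-project-∉first {b} b-even ∉b = trans (cong (push ∘ pull) (clear-∉first face {b} ∉b)) (push-pull b (∉first⇒PathFree {b} b-even ∉b))

  module Generating (B : List (Subset (m H))) (B-gen : EulerianGenerating H B) where
    private
      B-even = proj₁ B-gen
      gB = map (project face) B
      gB-gen : EulerianGenerating G gB
      gB-gen = project-EulerianGenerating face face-Eulerian face-pathEdge B-gen
      b* = ∃member∋first (proj₂ B-gen)
      1≤uses : 1 ≤ #uses B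
      1≤uses = 1≤#uses (proj₁ (proj₂ b*)) (proj₂ (proj₂ b*))
      bal = balanced B-even
      open Balance bal

    weightH-bound : weight facesH + 3 * #nonempty B ≤ weight B + 3 * length facesH
    weightH-bound = subst₂ (λ w l → w + 3 * #nonempty B ≤ weight B + 3 * l) (sym weight-facesH) (sym length-facesH)
      (weight-step (weight B) (weight gB) (weight faces) (#nonempty B) (#nonempty gB) (length faces) K (#uses B) slack
                   balance (weight-bound gB gB-gen) 1≤uses)

    module _ (ν≤ : #nonempty B ≤ suc (length faces)) (W≤ : weight B ≤ 3 + K + weight faces) where
      slack≡0 : slack ≡ 0
      slack≡0 = slack-vanishes (weight B) (weight gB) (weight faces) (#nonempty B) (#nonempty gB) (length faces) K (#uses B) slack
                  balance (weight-bound gB gB-gen) 1≤uses (subst (_≤ #nonempty B) length-facesH (facesH≤#nonempty B B-gen)) W≤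

      uses⇒face : All (λ b → lookup b first ≡ true → b ≡ face) B
      uses⇒face = no-slack⇒face slack≡0

      projection-tight : #nonempty gB ≤ length faces × weight gB ≤ weight faces
      projection-tight = tight-projection (weight B) (weight gB) (weight faces) (#nonempty B) (#nonempty gB) (length faces) K (#uses B)
                           (subst (λ s → weight B + 3 * #nonempty gB ≡ weight gB + 3 * #nonempty B + K * #uses B + s) slack≡0 balance)
                           (#nonempty-project-face B-even uses⇒face) 1≤uses ν≤ W≤

      projection-faces : (∀ b → b ∈ gB → 0 < ∣ b ∣ → b ∈ faces) × (∀ F → F ∈ faces → F ∈ gB)
      projection-faces = tight⇒faces gB gB-gen (proj₁ projection-tight) (proj₂ projection-tight)

      nonempty⇒face : ∀ b → b ∈ B → 0 < ∣ b ∣ → b ∈ facesH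
      nonempty⇒face b b∈B 0<∣b∣ = by-first (lookup b first) refl
        where
        b-even = All.lookup B-even b∈B
        by-first : ∀ t → lookup b first ≡ t → b ∈ facesH
        by-first true ∈b = here (All.lookup uses⇒face b∈B ∈b)
        by-first false ∉b = there (subst (_∈ map push faces) (push-project-∉first {b} b-even ∉b)
          (∈-map⁺ push (proj₁ projection-faces (project face b) (∈-map⁺ (project face) b∈B)
                                               (subst (0 <_) (sym (∣project∣-∉first {b} b-even ∉b)) 0<∣b∣))))

      push-project∈B : ∀ {b} → b ∈ B → project face b ∈ faces → push (project face b) ∈ B
      push-project∈B {b} b∈B pb∈faces = by-first (lookup b first) refl
        where
        by-first : ∀ t → lookup b first ≡ t → push (project face b) ∈ B
        by-first false ∉b = subst (_∈ B) (sym (push-project-∉first {b} (All.lookup B-even b∈B) ∉b)) b∈B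
        by-first true ∈b = ⊥-elim (<-irrefl (sym ∣project∣≡0) (face-nonempty pb∈faces))
          where
          ∣project∣≡0 : ∣ project face b ∣ ≡ 0
          ∣project∣≡0 = trans (cong (λ S → ∣ project face S ∣) (All.lookup uses⇒face b∈B ∈b)) (trans (cong ∣_∣ project-face) (∣⊥∣≡0 (m G)))

      face⇒member : ∀ F → F ∈ facesH → F ∈ B
      face⇒member F (here refl) = let (b , b∈B , ∈b) = b* in subst (_∈ B) (All.lookup uses⇒face b∈B ∈b) b∈B
      face⇒member F (there F∈) =
        let (F' , F'∈ , F≡pushF') = ∈-map⁻ push F∈
            (b , b∈B , F'≡pb) = ∈-map⁻ (project face) (proj₂ projection-faces F' F'∈)
        in subst (_∈ B) (sym (trans F≡pushF' (cong push F'≡pb))) (push-project∈B b∈B (subst (_∈ faces) F'≡pb F'∈))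

    tightH : #nonempty B ≤ length facesH → weight B ≤ weight facesH →
             (∀ b → b ∈ B → 0 < ∣ b ∣ → b ∈ facesH) × (∀ F → F ∈ facesH → F ∈ B)
    tightH ν≤ W≤ = nonempty⇒face ν≤' W≤' , face⇒member ν≤' W≤'
      where
      ν≤' = subst (#nonempty B ≤_) length-facesH ν≤
      W≤' = subst (weight B ≤_) weight-facesH W≤

  faceBasis : FaceBasis H
  faceBasis = record
    { faces = facesH
    ; faces-unique = facesH-unique
    ; ∈faces⇔induced = ∈facesH⇔induced
    ; faces-span = facesH-span
    ; faces≤#nonempty = facesH≤#nonempty
    ; weight-bound = λ B B-gen → Generating.weightH-bound B B-gen
    ; tight⇒faces = λ B B-gen → Generating.tightH B B-gen
    }


faceBasis : ∀ {G} → Polygonal2Tree G → FaceBasis G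
faceBasis (cycle G isCycle) = CycleGraph.faceBasis G isCycle
faceBasis (addPath G H t ext) = Step.faceBasis ext (faceBasis t)
theorem4 : (G : Graph) → Polygonal2Tree G →
    (I : List (EdgeSet G)) → Unique I → (∀ S → (S ∈ I) ⇔ IsInducedCycle G S) →
    IsMinimumCycleBasis G I ×
    (∀ B → IsMinimumCycleBasis G B → ∀ S → (S ∈ B) ⇔ (S ∈ I))
theorem4 G t I I-unique ∈I⇔induced = I-isMinimumCycleBasis , minimum⇒∈⇔∈I
  where open MinimumBasis (faceBasis t) I I-unique ∈I⇔induced
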